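{- Let $Q,M,M',t,v,v'$ be positive integers (with $t\le M$) and $0<\varepsilon<1$. Let $\vec a\sim\mathbb{Z}_Q^M$ and $\vec c\sim\mathbb{Z}_Q^{M'}$ be sampled uniformly at random. Then $$p_{\vec a,\vec c,I,J,t}\ \le\ (v+tv')\cdot v'\cdot\frac{1+\varepsilon}{1-\varepsilon}\cdot\frac{t}{M}$$ holds simultaneously for all $I\subseteq[M]$ with $|I|\le v$ and all $J\subseteq[M']$ with $|J|\le v'$, except with probability at most $$4MM'\,\frac{Q^{1/4}}{\varepsilon\cdot\binom{M-1}{t-1}^{1/4}}.$$
   Context: $t$-hitting probability: for $\vec a=(a_1,\ldots,a_M)\in\mathbb{Z}_Q^M$, $\vec c=(c_1,\ldots,c_{M'})\in\mathbb{Z}_Q^{M'}$, $I\subseteq[M]$, $J\subseteq[M']$ and a positive integer $t$, for each $j\in J$ independently sample a uniformly random $t$-element subset $S_j\subseteq[M]$ subject to $\sum_{i\in S_j}a_i\equiv c_j\pmod Q$ (if for some $j$ no such $S_j$ exists, the hitting probability is defined to be $1$). Then $p_{\vec a,\vec c,I,J,t}$ is the probability that there exist $j\ne j'$ in $J$ with $S_j\cap S_{j'}\neq\emptyset$, or some $j\in J$ with $S_j\cap I\ne\emptyset$.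
   Formalization: The parameter ε ranges only over the rationals strictly between 0 and 1. -}

module Defs where

open import Data.Bool using (Bool; true; false; _∧_; _∨_; not)
open import Data.Nat as ℕ using (ℕ; zero; suc; _≡ᵇ_; _≤ᵇ_; NonZero)
open import Data.Nat.DivMod using (_%_)
open import Data.Integer using (+_)
open import Data.Fin using (Fin; toℕ)
open import Data.Fin.Subset using (Subset; ∣_∣; _∩_)
open import Data.Vec as Vec using (Vec; []; _∷_; lookup)
open import Data.List as List using (List; []; _∷_; [_]; map; _++_; filterᵇ; length; allFin; concatMap)
open import Data.Bool.ListAction using (all; any)
open import Data.Rational as ℚ using (ℚ; 0ℚ; 1ℚ)

-- ℤ_Q is represented by Fin Q.  A vector in ℤ_Q^M is Vec (Fin Q) M.
-- A subset of [M] is Data.Fin.Subset.Subset M (characteristic vector).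

subsets : (n : ℕ) → List (Subset n)
subsets zero    = [ [] ]
subsets (suc n) = map (true ∷_) (subsets n) ++ map (false ∷_) (subsets n)

vectors : (Q n : ℕ) → List (Vec (Fin Q) n)
vectors Q zero    = [ [] ]
vectors Q (suc n) = concatMap (λ x → map (x ∷_) (vectors Q n)) (allFin Q)

disjointᵇ : ∀ {n} → Subset n → Subset n → Bool
disjointᵇ []       []       = true
disjointᵇ (x ∷ xs) (y ∷ ys) = not (x ∧ y) ∧ disjointᵇ xs ys

subsetSum : ∀ {Q n} → Vec (Fin Q) n → Subset n → ℕ
subsetSum []       []           = 0
subsetSum (a ∷ as) (true  ∷ s)  = toℕ a ℕ.+ subsetSum as s
subsetSum (a ∷ as) (false ∷ s)  = subsetSum as s

choices : ∀ {Q M} .{{_ : NonZero Q}} → Vec (Fin Q) M → ℕ → Fin Q → List (Subset M)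
choices {Q} {M} a t c =
  filterᵇ (λ S → (∣ S ∣ ≡ᵇ t) ∧ ((subsetSum a S % Q) ≡ᵇ toℕ c)) (subsets M)

elems : ∀ {n} → Subset n → List (Fin n)
elems {n} J = filterᵇ (lookup J) (allFin n)

tuples : ∀ {A : Set} → List (List A) → List (List A)
tuples []         = [ [] ]
tuples (xs ∷ xss) = concatMap (λ x → map (x ∷_) (tuples xss)) xs

pairwiseDisjointᵇ : ∀ {n} → List (Subset n) → Bool
pairwiseDisjointᵇ []       = true
pairwiseDisjointᵇ (S ∷ Ss) = all (disjointᵇ S) Ss ∧ pairwiseDisjointᵇ Ss

hitᵇ : ∀ {n} → Subset n → List (Subset n) → Bool
hitᵇ I Ss = not (pairwiseDisjointᵇ Ss ∧ all (disjointᵇ I) Ss)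

-- probability of an event = (#favourable) / (#total), uniform measure;
-- used only with total ≠ 0
frac : ℕ → ℕ → ℚ
frac k zero    = 0ℚ
frac k (suc d) = + k ℚ./ suc d

-- The joint sample space is the product over j ∈ J of the uniform distributions on
-- choices a t c_j; if some choices list is empty, the product is empty and p := 1.
hittingProb : ∀ {Q M M'} .{{_ : NonZero Q}} →
  Vec (Fin Q) M → Vec (Fin Q) M' → Subset M → Subset M' → ℕ → ℚ
hittingProb a c I J t with tuples (map (λ j → choices a t (lookup c j)) (elems J))
... | []        = 1ℚ
... | ts@(_ ∷ _) = frac (length (filterᵇ (hitᵇ I) ts)) (length ts)

-- the bound  (v + t v') · v' · (1+ε)/(1−ε) · t/M  fails for (I,J), i.e.
--   p > (v + t v') · v' · (1+ε)/(1−ε) · t/M,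
-- written equivalently (as 1−ε > 0 and M > 0) as  p · (1−ε) · M > (v+tv')·v'·(1+ε)·t
boundFailsᵇ : ∀ {Q M M'} .{{_ : NonZero Q}} → ℕ → ℕ → ℚ →
  Vec (Fin Q) M → Vec (Fin Q) M' → Subset M → Subset M' → ℕ → Bool
boundFailsᵇ {M = M} v v' ε a c I J t =
  not ((hittingProb a c I J t ℚ.* (1ℚ ℚ.- ε) ℚ.* (+ M ℚ./ 1))
        ℚ.≤ᵇ ((+ ((v ℕ.+ t ℕ.* v') ℕ.* v') ℚ./ 1) ℚ.* (1ℚ ℚ.+ ε) ℚ.* (+ t ℚ./ 1)))

badᵇ : ∀ {Q M M'} .{{_ : NonZero Q}} → ℕ → ℕ → ℕ → ℚ →
  Vec (Fin Q) M → Vec (Fin Q) M' → Bool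
badᵇ {M = M} {M'} t v v' ε a c =
  any (λ I → (∣ I ∣ ≤ᵇ v) ∧
    any (λ J → (∣ J ∣ ≤ᵇ v') ∧ boundFailsᵇ v v' ε a c I J t) (subsets M'))
    (subsets M)

badProb : (Q M M' : ℕ) .{{_ : NonZero Q}} → ℕ → ℕ → ℕ → ℚ → ℚ
badProb Q M M' t v v' ε =
  frac (length (filterᵇ (λ ac → badᵇ t v v' ε (Data.Product.proj₁ ac) (Data.Product.proj₂ ac))
                 (List.cartesianProduct (vectors Q M) (vectors Q M'))))
       (ℕ._^_ Q M ℕ.* ℕ._^_ Q M')
  where import Data.Product

_⁴ : ℚ → ℚ
x ⁴ = x ℚ.* x ℚ.* x ℚ.* x

-- Fix a point i and a residue c, and let N(a) count the t-subsets S ∋ i with Σ_{j ∈ S} a_j ≡ c (mod Q).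
-- For uniform a the event Σ_S a ≡ c has probability 1/Q for every nonempty S, and for two distinct
-- subsets of the same size the two events are independent, since each subset has a coordinate the
-- other lacks. Hence Q·N(a) has mean K = C(M-1, t-1) and variance below K·Q, and Chebyshev bounds the
-- probability that Q·N(a) leaves [(1-ε)K, (1+ε)K] by Q/(ε²K). Only the uniform coordinate c_j of c
-- matters, so a union bound over the M·M' pairs (i, j) bounds the probability that some count deviates
-- by M M' Q/(ε²K). If none deviates, every list of choices for c_j meets each point in at most a
-- (1+ε)/(1-ε)·t/M fraction of its sets, and a union bound over the at most |I|·|J| + t·|J|² possible
-- collisions bounds the hitting probability. Together with the trivial bound 1 this gives the stated
-- fourth-root bound.

module Submission where

open import Defs
open import Data.Bool using (Bool; true; false; _∧_; not; T)
open import Data.Bool.ListAction using (all; any)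
open import Data.Unit using (tt)
open import Data.Empty using (⊥-elim)
open import Data.Product using (_×_; _,_; proj₁; proj₂)
open import Data.Sum using (inj₁; inj₂)
open import Data.Nat as ℕ using (ℕ; zero; suc; _+_; _*_; _∸_; _≤_; _<_; z≤n; s≤s; _^_; NonZero; _≡ᵇ_; _≤ᵇ_; ∣_-_∣)
open import Data.Nat.Properties
open import Data.Nat.DivMod
open import Algebra.Properties.CommutativeSemigroup +-commutativeSemigroup
  using () renaming (interchange to +-interchange; xy∙z≈xz∙y to +-xy∙z≈xz∙y)
open import Data.Nat.Tactic.RingSolver using (solve-∀)
open import Data.Nat.Combinatorics using (_C_; nCk+nC[k+1]≡[n+1]C[k+1])
open import Data.Nat.Coprimality using (Coprime)
open import Data.List as List using (List; []; _∷_; map; _++_; filterᵇ; length; allFin; concatMap; tabulate)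
open import Data.List.Relation.Unary.All as All using (All; []; _∷_)
open import Data.List.Relation.Unary.All.Properties using (map⁺; all-filter)
open import Data.List.Properties using (length-map)
open import Data.Vec using (Vec; []; _∷_; lookup)
open import Data.Fin.Subset using (Subset; ∣_∣)
open import Data.Fin using (Fin; toℕ; zero; suc)
open import Data.Fin.Properties using (toℕ<n)
open import Relation.Binary.PropositionalEquality
open import Relation.Nullary using (¬_; Dec; yes; no)
open import Function using (_∘_)
import Data.Integer as ℤ
import Data.Integer.Properties as ℤP
open import Data.Integer.Tactic.RingSolver using () renaming (solve-∀ to solveℤ-∀)
open import Data.Rational as ℚ using (ℚ; mkℚ; 0ℚ; 1ℚ; toℚᵘ)
import Data.Rational.Properties as ℚP
open import Data.Rational.Unnormalised as ℚᵘ using (ℚᵘ; mkℚᵘ; ↥_; ↧_; *≡*; *≤*)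
import Data.Rational.Unnormalised.Properties as ℚᵘP

⟦_⟧ : Bool → ℕ
⟦ true ⟧ = 1
⟦ false ⟧ = 0

⟦⟧≤1 : ∀ b → ⟦ b ⟧ ≤ 1
⟦⟧≤1 true = s≤s z≤n
⟦⟧≤1 false = z≤n

⟦⟧-idem : ∀ b → ⟦ b ⟧ * ⟦ b ⟧ ≡ ⟦ b ⟧
⟦⟧-idem true = refl
⟦⟧-idem false = refl

⟦⟧≡0⇒false : ∀ b → ⟦ b ⟧ ≡ 0 → b ≡ false
⟦⟧≡0⇒false false _ = refl

⟦∧⟧ : ∀ b c → ⟦ b ∧ c ⟧ ≡ ⟦ b ⟧ * ⟦ c ⟧
⟦∧⟧ true c = sym (+-identityʳ ⟦ c ⟧)
⟦∧⟧ false c = refl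

T⇒≡true : ∀ {b} → T b → b ≡ true
T⇒≡true {true} _ = refl

false≢true : false ≢ true
false≢true ()


∑ : {A : Set} → List A → (A → ℕ) → ℕ
∑ [] f = 0
∑ (x ∷ xs) f = f x + ∑ xs f

∑-cong : {A : Set} (xs : List A) {f g : A → ℕ} → (∀ x → f x ≡ g x) → ∑ xs f ≡ ∑ xs g
∑-cong [] e = refl
∑-cong (x ∷ xs) e = cong₂ _+_ (e x) (∑-cong xs e)

∑-mono-≤ : {A : Set} (xs : List A) {f g : A → ℕ} → (∀ x → f x ≤ g x) → ∑ xs f ≤ ∑ xs g
∑-mono-≤ [] e = z≤n
∑-mono-≤ (x ∷ xs) e = +-mono-≤ (e x) (∑-mono-≤ xs e)

∑-++ : {A : Set} (xs ys : List A) (f : A → ℕ) → ∑ (xs ++ ys) f ≡ ∑ xs f + ∑ ys f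
∑-++ [] ys f = refl
∑-++ (x ∷ xs) ys f = trans (cong (f x +_) (∑-++ xs ys f)) (sym (+-assoc (f x) _ _))

∑-map : {A B : Set} (g : A → B) (xs : List A) (f : B → ℕ) → ∑ (map g xs) f ≡ ∑ xs (λ x → f (g x))
∑-map g [] f = refl
∑-map g (x ∷ xs) f = cong (f (g x) +_) (∑-map g xs f)

∑-concatMap : {A B : Set} (g : A → List B) (xs : List A) (f : B → ℕ) →
  ∑ (concatMap g xs) f ≡ ∑ xs (λ x → ∑ (g x) f)
∑-concatMap g [] f = refl
∑-concatMap g (x ∷ xs) f = trans (∑-++ (g x) _ f) (cong (∑ (g x) f +_) (∑-concatMap g xs f))

∑-zero : {A : Set} (xs : List A) → ∑ xs (λ _ → 0) ≡ 0
∑-zero [] = refl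
∑-zero (_ ∷ xs) = ∑-zero xs

∑-cong-zero : {A : Set} (xs : List A) {f : A → ℕ} → (∀ x → f x ≡ 0) → ∑ xs f ≡ 0
∑-cong-zero xs e = trans (∑-cong xs e) (∑-zero xs)

∑-distrib-+ : {A : Set} (xs : List A) (f g : A → ℕ) → ∑ xs (λ x → f x + g x) ≡ ∑ xs f + ∑ xs g
∑-distrib-+ [] f g = refl
∑-distrib-+ (x ∷ xs) f g = trans (cong ((f x + g x) +_) (∑-distrib-+ xs f g)) (+-interchange (f x) (g x) _ _)

∑-*ˡ : {A : Set} (xs : List A) (k : ℕ) (f : A → ℕ) → ∑ xs (λ x → k * f x) ≡ k * ∑ xs f
∑-*ˡ [] k f = sym (*-zeroʳ k)
∑-*ˡ (x ∷ xs) k f = trans (cong (k * f x +_) (∑-*ˡ xs k f)) (sym (*-distribˡ-+ k (f x) _))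

∑-*ʳ : {A : Set} (xs : List A) (k : ℕ) (f : A → ℕ) → ∑ xs (λ x → f x * k) ≡ ∑ xs f * k
∑-*ʳ xs k f = trans (∑-cong xs (λ x → *-comm (f x) k)) (trans (∑-*ˡ xs k f) (*-comm k _))

∑-const : {A : Set} (xs : List A) (k : ℕ) → ∑ xs (λ _ → k) ≡ length xs * k
∑-const [] k = refl
∑-const (x ∷ xs) k = cong (k +_) (∑-const xs k)

∑-comm : {A B : Set} (xs : List A) (ys : List B) (f : A → B → ℕ) →
  ∑ xs (λ x → ∑ ys (f x)) ≡ ∑ ys (λ y → ∑ xs (λ x → f x y))
∑-comm [] ys f = sym (∑-zero ys)
∑-comm (x ∷ xs) ys f = trans (cong (∑ ys (f x) +_) (∑-comm xs ys f)) (sym (∑-distrib-+ ys (f x) _))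

∑-square : {A : Set} (xs : List A) (f : A → ℕ) → ∑ xs f * ∑ xs f ≡ ∑ xs (λ x → ∑ xs (λ y → f x * f y))
∑-square xs f = trans (sym (∑-*ʳ xs (∑ xs f) f)) (∑-cong xs (λ x → sym (∑-*ˡ xs (f x) f)))

length-filter : {A : Set} (p : A → Bool) (xs : List A) → length (filterᵇ p xs) ≡ ∑ xs (λ x → ⟦ p x ⟧)
length-filter p [] = refl
length-filter p (x ∷ xs) with p x
... | true = cong suc (length-filter p xs)
... | false = length-filter p xs

∑-filter : {A : Set} (p : A → Bool) (xs : List A) (f : A → ℕ) →
  ∑ (filterᵇ p xs) f ≡ ∑ xs (λ x → ⟦ p x ⟧ * f x)
∑-filter p [] f = refl
∑-filter p (x ∷ xs) f with p x
... | true = cong₂ _+_ (sym (+-identityʳ (f x))) (∑-filter p xs f)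
... | false = ∑-filter p xs f

∑-cartesianProduct : {A B : Set} (xs : List A) (ys : List B) (f : A × B → ℕ) →
  ∑ (List.cartesianProduct xs ys) f ≡ ∑ xs (λ x → ∑ ys (λ y → f (x , y)))
∑-cartesianProduct [] ys f = refl
∑-cartesianProduct (x ∷ xs) ys f =
  trans (∑-++ (map (x ,_) ys) _ f) (cong₂ _+_ (∑-map (x ,_) ys f) (∑-cartesianProduct xs ys f))

∑-tuples : {A : Set} (L : List A) (Ls : List (List A)) (f : List A → ℕ) →
  ∑ (tuples (L ∷ Ls)) f ≡ ∑ L (λ S → ∑ (tuples Ls) (λ ss → f (S ∷ ss)))
∑-tuples L Ls f = trans (∑-concatMap _ L f) (∑-cong L (λ S → ∑-map (S ∷_) (tuples Ls) f))

∑Fin : (n : ℕ) → (Fin n → ℕ) → ℕ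
∑Fin zero f = 0
∑Fin (suc n) f = f zero + ∑Fin n (λ i → f (suc i))

∑Fin-cong : ∀ n {f g : Fin n → ℕ} → (∀ i → f i ≡ g i) → ∑Fin n f ≡ ∑Fin n g
∑Fin-cong zero e = refl
∑Fin-cong (suc n) e = cong₂ _+_ (e zero) (∑Fin-cong n (λ i → e (suc i)))

∑Fin-mono-≤ : ∀ n {f g : Fin n → ℕ} → (∀ i → f i ≤ g i) → ∑Fin n f ≤ ∑Fin n g
∑Fin-mono-≤ zero _ = z≤n
∑Fin-mono-≤ (suc n) le = +-mono-≤ (le zero) (∑Fin-mono-≤ n (λ i → le (suc i)))

∑Fin-const : ∀ n k → ∑Fin n (λ _ → k) ≡ n * k
∑Fin-const zero k = refl
∑Fin-const (suc n) k = cong (k +_) (∑Fin-const n k)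

∑Fin-distrib-+ : ∀ n (f g : Fin n → ℕ) → ∑Fin n (λ i → f i + g i) ≡ ∑Fin n f + ∑Fin n g
∑Fin-distrib-+ zero f g = refl
∑Fin-distrib-+ (suc n) f g = trans (cong (f zero + g zero +_) (∑Fin-distrib-+ n _ _)) (+-interchange (f zero) (g zero) _ _)

∑Fin-*ʳ : ∀ n (f : Fin n → ℕ) k → ∑Fin n (λ i → f i * k) ≡ ∑Fin n f * k
∑Fin-*ʳ zero f k = refl
∑Fin-*ʳ (suc n) f k = trans (cong (f zero * k +_) (∑Fin-*ʳ n _ k)) (sym (*-distribʳ-+ k (f zero) _))

∑Fin≡0⇒≡0 : ∀ n (f : Fin n → ℕ) → ∑Fin n f ≡ 0 → ∀ i → f i ≡ 0
∑Fin≡0⇒≡0 (suc n) f e zero = m+n≡0⇒m≡0 (f zero) e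
∑Fin≡0⇒≡0 (suc n) f e (suc i) = ∑Fin≡0⇒≡0 n (λ i → f (suc i)) (m+n≡0⇒n≡0 (f zero) e) i

∑Fin-toℕ≡ : ∀ n e → e < n → ∑Fin n (λ i → ⟦ toℕ i ≡ᵇ e ⟧) ≡ 1
∑Fin-toℕ≡ (suc n) zero _ = cong suc (trans (∑Fin-const n 0) (*-zeroʳ n))
∑Fin-toℕ≡ (suc n) (suc e) (s≤s e<n) = ∑Fin-toℕ≡ n e e<n

∑-∑Fin-comm : {A : Set} (xs : List A) (n : ℕ) (f : A → Fin n → ℕ) →
  ∑ xs (λ x → ∑Fin n (f x)) ≡ ∑Fin n (λ i → ∑ xs (λ x → f x i))
∑-∑Fin-comm [] n f = sym (trans (∑Fin-const n 0) (*-zeroʳ n))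
∑-∑Fin-comm (x ∷ xs) n f = trans (cong (∑Fin n (f x) +_) (∑-∑Fin-comm xs n f)) (sym (∑Fin-distrib-+ n _ _))

∑-tabulate : {A : Set} (n : ℕ) (g : Fin n → A) (f : A → ℕ) → ∑ (tabulate g) f ≡ ∑Fin n (λ i → f (g i))
∑-tabulate zero g f = refl
∑-tabulate (suc n) g f = cong (f (g zero) +_) (∑-tabulate n (λ i → g (suc i)) f)

∑-allFin : (n : ℕ) (f : Fin n → ℕ) → ∑ (allFin n) f ≡ ∑Fin n f
∑-allFin n f = ∑-tabulate n (λ i → i) f

∑-allFin-const : (n k : ℕ) → ∑ (allFin n) (λ _ → k) ≡ n * k
∑-allFin-const n k = trans (∑-allFin n _) (∑Fin-const n k)

∣S∣≡∑Fin : ∀ {n} (S : Subset n) → ∣ S ∣ ≡ ∑Fin n (λ i → ⟦ lookup S i ⟧)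
∣S∣≡∑Fin [] = refl
∣S∣≡∑Fin (true ∷ S) = cong suc (∣S∣≡∑Fin S)
∣S∣≡∑Fin (false ∷ S) = ∣S∣≡∑Fin S

∑-∑Fin-weighted : ∀ {n} {X : Set} (xs : List X) (W : Subset n) (g : X → Fin n → ℕ) →
  ∑ xs (λ x → ∑Fin n (λ i → ⟦ lookup W i ⟧ * g x i)) ≡ ∑Fin n (λ i → ⟦ lookup W i ⟧ * ∑ xs (λ x → g x i))
∑-∑Fin-weighted {n} xs W g =
  trans (∑-∑Fin-comm xs n _) (∑Fin-cong n (λ i → ∑-*ˡ xs ⟦ lookup W i ⟧ (λ x → g x i)))

∑Fin-weighted-bound : ∀ {n} A (W : Subset n) (f : Fin n → ℕ) b → (∀ i → f i * A ≤ b) →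
  ∑Fin n (λ i → ⟦ lookup W i ⟧ * f i) * A ≤ ∣ W ∣ * b
∑Fin-weighted-bound {n} A W f b f≤ = begin
  ∑Fin n (λ i → ⟦ lookup W i ⟧ * f i) * A   ≡⟨ ∑Fin-*ʳ n _ A ⟨
  ∑Fin n (λ i → ⟦ lookup W i ⟧ * f i * A)   ≤⟨ ∑Fin-mono-≤ n weighted-f≤ ⟩
  ∑Fin n (λ i → ⟦ lookup W i ⟧ * b)         ≡⟨ ∑Fin-*ʳ n _ b ⟩
  ∑Fin n (λ i → ⟦ lookup W i ⟧) * b         ≡⟨ cong (_* b) (∣S∣≡∑Fin W) ⟨
  ∣ W ∣ * b                                 ∎
  where
  open ≤-Reasoning
  weighted-f≤ : ∀ i → ⟦ lookup W i ⟧ * f i * A ≤ ⟦ lookup W i ⟧ * b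
  weighted-f≤ i = ≤-trans (≤-reflexive (*-assoc ⟦ lookup W i ⟧ (f i) A)) (*-monoʳ-≤ ⟦ lookup W i ⟧ (f≤ i))

∑-vectors-suc : (Q n : ℕ) (f : Vec (Fin Q) (suc n) → ℕ) →
  ∑ (vectors Q (suc n)) f ≡ ∑ (allFin Q) (λ x → ∑ (vectors Q n) (λ a → f (x ∷ a)))
∑-vectors-suc Q n f = trans (∑-concatMap _ (allFin Q) f) (∑-cong (allFin Q) (λ x → ∑-map (x ∷_) (vectors Q n) f))

count-vectors : (Q n : ℕ) → ∑ (vectors Q n) (λ _ → 1) ≡ Q ^ n
count-vectors Q zero = refl
count-vectors Q (suc n) = begin
  ∑ (vectors Q (suc n)) (λ _ → 1)                ≡⟨ ∑-vectors-suc Q n (λ _ → 1) ⟩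
  ∑ (allFin Q) (λ _ → ∑ (vectors Q n) (λ _ → 1)) ≡⟨ ∑-cong (allFin Q) (λ _ → count-vectors Q n) ⟩
  ∑ (allFin Q) (λ _ → Q ^ n)                     ≡⟨ ∑-allFin-const Q (Q ^ n) ⟩
  Q * Q ^ n                                      ∎
  where open ≡-Reasoning

∑-vectors-const : (Q n k : ℕ) → ∑ (vectors Q n) (λ _ → k) ≡ Q ^ n * k
∑-vectors-const Q n k = begin
  ∑ (vectors Q n) (λ _ → k)     ≡⟨ ∑-cong (vectors Q n) (λ _ → sym (*-identityˡ k)) ⟩
  ∑ (vectors Q n) (λ _ → 1 * k) ≡⟨ ∑-*ʳ (vectors Q n) k (λ _ → 1) ⟩
  ∑ (vectors Q n) (λ _ → 1) * k ≡⟨ cong (_* k) (count-vectors Q n) ⟩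
  Q ^ n * k                     ∎
  where open ≡-Reasoning

∑-vectors-lookup : ∀ Q n (j : Fin n) (g : Fin Q → ℕ) →
  Q * ∑ (vectors Q n) (λ c → g (lookup c j)) ≡ Q ^ n * ∑ (allFin Q) g
∑-vectors-lookup Q (suc n) zero g = begin
  Q * ∑ (vectors Q (suc n)) (λ c → g (lookup c zero)) ≡⟨ cong (Q *_) (∑-vectors-suc Q n _) ⟩
  Q * ∑ (allFin Q) (λ x → ∑ (vectors Q n) (λ _ → g x)) ≡⟨ cong (Q *_) (∑-cong (allFin Q) (λ x → ∑-vectors-const Q n (g x))) ⟩
  Q * ∑ (allFin Q) (λ x → Q ^ n * g x)                 ≡⟨ cong (Q *_) (∑-*ˡ (allFin Q) (Q ^ n) g) ⟩
  Q * (Q ^ n * ∑ (allFin Q) g)                         ≡⟨ *-assoc Q _ _ ⟨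
  Q ^ suc n * ∑ (allFin Q) g                           ∎
  where open ≡-Reasoning
∑-vectors-lookup Q (suc n) (suc j) g = begin
  Q * ∑ (vectors Q (suc n)) (λ c → g (lookup c (suc j))) ≡⟨ cong (Q *_) (trans (∑-vectors-suc Q n _) (∑-allFin-const Q _)) ⟩
  Q * (Q * ∑ (vectors Q n) (λ c → g (lookup c j)))        ≡⟨ cong (Q *_) (∑-vectors-lookup Q n j g) ⟩
  Q * (Q ^ n * ∑ (allFin Q) g)                            ≡⟨ *-assoc Q _ _ ⟨
  Q ^ suc n * ∑ (allFin Q) g                              ∎
  where open ≡-Reasoning

T⇔T⇒≡ : {b b' : Bool} → (T b → T b') → (T b' → T b) → b ≡ b'
T⇔T⇒≡ {true} {true} f g = refl
T⇔T⇒≡ {true} {false} f g = ⊥-elim (f tt)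
T⇔T⇒≡ {false} {true} f g = ⊥-elim (g tt)
T⇔T⇒≡ {false} {false} f g = refl

module _ (Q : ℕ) .{{_ : NonZero Q}} where

  [m%n+k]%n≡[m+k]%n : ∀ m k → (m % Q + k) % Q ≡ (m + k) % Q
  [m%n+k]%n≡[m+k]%n m k = begin
    (m % Q + k) % Q         ≡⟨ %-distribˡ-+ (m % Q) k Q ⟩
    (m % Q % Q + k % Q) % Q ≡⟨ cong (λ u → (u + k % Q) % Q) (m%n%n≡m%n m Q) ⟩
    (m % Q + k % Q) % Q     ≡⟨ %-distribˡ-+ m k Q ⟨
    (m + k) % Q             ∎
    where open ≡-Reasoning

  [m+k%n]%n≡[m+k]%n : ∀ m k → (m + k % Q) % Q ≡ (m + k) % Q
  [m+k%n]%n≡[m+k]%n m k = begin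
    (m + k % Q) % Q ≡⟨ cong (_% Q) (+-comm m (k % Q)) ⟩
    (k % Q + m) % Q ≡⟨ [m%n+k]%n≡[m+k]%n k m ⟩
    (k + m) % Q     ≡⟨ cong (_% Q) (+-comm k m) ⟩
    (m + k) % Q     ∎
    where open ≡-Reasoning

  _-ₘ_ : ℕ → ℕ → ℕ
  c -ₘ y = (c + (Q ∸ y % Q)) % Q

  -ₘ<n : ∀ c y → c -ₘ y < Q
  -ₘ<n c y = m%n<n _ Q

  [m+[n∸y%n]+y]%n≡m%n : ∀ m y → (m + (Q ∸ y % Q) + y) % Q ≡ m % Q
  [m+[n∸y%n]+y]%n≡m%n m y = begin
    (m + d + y) % Q     ≡⟨ [m+k%n]%n≡[m+k]%n (m + d) y ⟨
    (m + d + y % Q) % Q ≡⟨ cong (_% Q) (trans (+-assoc m d (y % Q)) (cong (m +_) (trans (+-comm d (y % Q)) (m+[n∸m]≡n (<⇒≤ (m%n<n y Q)))))) ⟩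
    (m + Q) % Q         ≡⟨ [m+n]%n≡m%n m Q ⟩
    m % Q               ∎
    where
    open ≡-Reasoning
    d : ℕ
    d = Q ∸ y % Q

  [z+y]%n≡ᵇc≡z%n≡ᵇc-ₘy : ∀ z y c → c < Q → ((z + y) % Q ≡ᵇ c) ≡ (z % Q ≡ᵇ c -ₘ y)
  [z+y]%n≡ᵇc≡z%n≡ᵇc-ₘy z y c c<Q = T⇔T⇒≡
    (λ h → ≡⇒≡ᵇ _ _ (sym (solution⇒ (≡ᵇ⇒≡ _ _ h))))
    (λ h → ≡⇒≡ᵇ _ _ (⇒solution (≡ᵇ⇒≡ _ _ h)))
    where
    open ≡-Reasoning
    d : ℕ
    d = Q ∸ y % Q
    solution⇒ : (z + y) % Q ≡ c → c -ₘ y ≡ z % Q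
    solution⇒ e = begin
      (c + d) % Q             ≡⟨ cong (λ u → (u + d) % Q) e ⟨
      ((z + y) % Q + d) % Q   ≡⟨ [m%n+k]%n≡[m+k]%n (z + y) d ⟩
      (z + y + d) % Q         ≡⟨ cong (_% Q) (+-xy∙z≈xz∙y z y d) ⟩
      (z + d + y) % Q         ≡⟨ [m+[n∸y%n]+y]%n≡m%n z y ⟩
      z % Q                   ∎
    ⇒solution : z % Q ≡ c -ₘ y → (z + y) % Q ≡ c
    ⇒solution e = begin
      (z + y) % Q             ≡⟨ [m%n+k]%n≡[m+k]%n z y ⟨
      (z % Q + y) % Q         ≡⟨ cong (λ u → (u + y) % Q) e ⟩
      ((c + d) % Q + y) % Q   ≡⟨ [m%n+k]%n≡[m+k]%n (c + d) y ⟩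
      (c + d + y) % Q         ≡⟨ [m+[n∸y%n]+y]%n≡m%n c y ⟩
      c % Q                   ≡⟨ m<n⇒m%n≡m c<Q ⟩
      c                       ∎

  count-x+s≡c : ∀ s c → c < Q → ∑ (allFin Q) (λ x → ⟦ (toℕ x + s) % Q ≡ᵇ c ⟧) ≡ 1
  count-x+s≡c s c c<Q = begin
    ∑ (allFin Q) (λ x → ⟦ (toℕ x + s) % Q ≡ᵇ c ⟧) ≡⟨ ∑-allFin Q _ ⟩
    ∑Fin Q (λ x → ⟦ (toℕ x + s) % Q ≡ᵇ c ⟧)       ≡⟨ ∑Fin-cong Q (λ x → cong ⟦_⟧ (reduce x)) ⟩
    ∑Fin Q (λ x → ⟦ toℕ x ≡ᵇ c -ₘ s ⟧)            ≡⟨ ∑Fin-toℕ≡ Q _ (-ₘ<n c s) ⟩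
    1                                            ∎
    where
    open ≡-Reasoning
    reduce : ∀ x → ((toℕ x + s) % Q ≡ᵇ c) ≡ (toℕ x ≡ᵇ c -ₘ s)
    reduce x = trans ([z+y]%n≡ᵇc≡z%n≡ᵇc-ₘy (toℕ x) s c c<Q) (cong (_≡ᵇ c -ₘ s) (m<n⇒m%n≡m (toℕ<n x)))

data NonEmpty : ∀ {n} → Subset n → Set where
  here  : ∀ {n} {S : Subset n} → NonEmpty (true ∷ S)
  there : ∀ {n} {b} {S : Subset n} → NonEmpty S → NonEmpty (b ∷ S)

data _⊈_ : ∀ {n} → Subset n → Subset n → Set where
  here  : ∀ {n} {S S' : Subset n} → (true ∷ S) ⊈ (false ∷ S')
  there : ∀ {n} {b b'} {S S' : Subset n} → S ⊈ S' → (b ∷ S) ⊈ (b' ∷ S')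

⊈⇒NonEmpty : ∀ {n} {S S' : Subset n} → S ⊈ S' → NonEmpty S
⊈⇒NonEmpty here = here
⊈⇒NonEmpty (there d) = there (⊈⇒NonEmpty d)

∈⇒NonEmpty : ∀ {n} (S : Subset n) (i : Fin n) → lookup S i ≡ true → NonEmpty S
∈⇒NonEmpty (true ∷ S) zero e = here
∈⇒NonEmpty (x ∷ S) (suc i) e = there (∈⇒NonEmpty S i e)

module _ (Q : ℕ) .{{_ : NonZero Q}} where

  hasSum : ∀ {n} → Vec (Fin Q) n → Subset n → ℕ → ℕ
  hasSum a S c = ⟦ subsetSum a S % Q ≡ᵇ c ⟧

  hasSum-true∷ : ∀ {n} x (a : Vec (Fin Q) n) S c → c < Q →
    hasSum (x ∷ a) (true ∷ S) c ≡ hasSum a S (_-ₘ_ Q c (toℕ x))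
  hasSum-true∷ x a S c c<Q = cong ⟦_⟧ (trans
    (cong (λ u → u % Q ≡ᵇ c) (+-comm (toℕ x) (subsetSum a S)))
    ([z+y]%n≡ᵇc≡z%n≡ᵇc-ₘy Q (subsetSum a S) (toℕ x) c c<Q))

  -- The fresh coordinate x makes x + s a uniform, whatever s a is.
  ∑-uniform-shift : ∀ n (s g : Vec (Fin Q) n → ℕ) c → c < Q →
    ∑ (allFin Q) (λ x → ∑ (vectors Q n) (λ a → ⟦ (toℕ x + s a) % Q ≡ᵇ c ⟧ * g a)) ≡ ∑ (vectors Q n) g
  ∑-uniform-shift n s g c c<Q = begin
    ∑ (allFin Q) (λ x → ∑ (vectors Q n) (λ a → ⟦ (toℕ x + s a) % Q ≡ᵇ c ⟧ * g a))
      ≡⟨ ∑-comm (allFin Q) (vectors Q n) _ ⟩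
    ∑ (vectors Q n) (λ a → ∑ (allFin Q) (λ x → ⟦ (toℕ x + s a) % Q ≡ᵇ c ⟧ * g a))
      ≡⟨ ∑-cong (vectors Q n) (λ a → ∑-*ʳ (allFin Q) (g a) _) ⟩
    ∑ (vectors Q n) (λ a → ∑ (allFin Q) (λ x → ⟦ (toℕ x + s a) % Q ≡ᵇ c ⟧) * g a)
      ≡⟨ ∑-cong (vectors Q n) (λ a → cong (_* g a) (count-x+s≡c Q (s a) c c<Q)) ⟩
    ∑ (vectors Q n) (λ a → 1 * g a)
      ≡⟨ ∑-cong (vectors Q n) (λ a → *-identityˡ (g a)) ⟩
    ∑ (vectors Q n) g ∎
    where open ≡-Reasoning

  count-hasSum : ∀ n (S : Subset n) c → c < Q → NonEmpty S → ∑ (vectors Q n) (λ a → hasSum a S c) * Q ≡ Q ^ n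
  count-hasSum (suc n) (true ∷ S) c c<Q _ = begin
    ∑ (vectors Q (suc n)) (λ a → hasSum a (true ∷ S) c) * Q
      ≡⟨ cong (_* Q) (∑-vectors-suc Q n _) ⟩
    ∑ (allFin Q) (λ x → ∑ (vectors Q n) (λ a → hasSum (x ∷ a) (true ∷ S) c)) * Q
      ≡⟨ cong (_* Q) (∑-cong (allFin Q) (λ x → ∑-cong (vectors Q n) (λ a → sym (*-identityʳ _)))) ⟩
    ∑ (allFin Q) (λ x → ∑ (vectors Q n) (λ a → hasSum (x ∷ a) (true ∷ S) c * 1)) * Q
      ≡⟨ cong (_* Q) (∑-uniform-shift n (λ a → subsetSum a S) (λ _ → 1) c c<Q) ⟩
    ∑ (vectors Q n) (λ _ → 1) * Q
      ≡⟨ cong (_* Q) (count-vectors Q n) ⟩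
    Q ^ n * Q
      ≡⟨ *-comm (Q ^ n) Q ⟩
    Q ^ suc n ∎
    where open ≡-Reasoning
  count-hasSum (suc n) (false ∷ S) c c<Q (there ne) = begin
    ∑ (vectors Q (suc n)) (λ a → hasSum a (false ∷ S) c) * Q
      ≡⟨ cong (_* Q) (∑-vectors-suc Q n _) ⟩
    ∑ (allFin Q) (λ x → ∑ (vectors Q n) (λ a → hasSum a S c)) * Q
      ≡⟨ cong (_* Q) (∑-allFin-const Q _) ⟩
    Q * ∑ (vectors Q n) (λ a → hasSum a S c) * Q
      ≡⟨ *-assoc Q _ Q ⟩
    Q * (∑ (vectors Q n) (λ a → hasSum a S c) * Q)
      ≡⟨ cong (Q *_) (count-hasSum n S c c<Q ne) ⟩
    Q ^ suc n ∎
    where open ≡-Reasoning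

  hasSum-pair : ∀ {n} → Vec (Fin Q) n → Subset n → ℕ → Subset n → ℕ → ℕ
  hasSum-pair a S c S' c' = hasSum a S c * hasSum a S' c'

  private
    count-hasSum-pair-true∷false∷ : ∀ n (S S' : Subset n) c c' → c < Q → c' < Q → NonEmpty S' →
      ∑ (vectors Q (suc n)) (λ a → hasSum-pair a (true ∷ S) c (false ∷ S') c') * (Q * Q) ≡ Q ^ suc n
    count-hasSum-pair-true∷false∷ n S S' c c' c<Q c'<Q ne = begin
      ∑ (vectors Q (suc n)) (λ a → hasSum-pair a (true ∷ S) c (false ∷ S') c') * (Q * Q)
        ≡⟨ cong (_* (Q * Q)) (∑-vectors-suc Q n _) ⟩
      ∑ (allFin Q) (λ x → ∑ (vectors Q n) (λ a → hasSum (x ∷ a) (true ∷ S) c * hasSum a S' c')) * (Q * Q)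
        ≡⟨ cong (_* (Q * Q)) (∑-uniform-shift n (λ a → subsetSum a S) (λ a → hasSum a S' c') c c<Q) ⟩
      ∑ (vectors Q n) (λ a → hasSum a S' c') * (Q * Q)
        ≡⟨ *-assoc (∑ (vectors Q n) (λ a → hasSum a S' c')) Q Q ⟨
      ∑ (vectors Q n) (λ a → hasSum a S' c') * Q * Q
        ≡⟨ cong (_* Q) (count-hasSum n S' c' c'<Q ne) ⟩
      Q ^ n * Q
        ≡⟨ *-comm (Q ^ n) Q ⟩
      Q ^ suc n ∎
      where open ≡-Reasoning

  count-hasSum-pair : ∀ n (S S' : Subset n) c c' → c < Q → c' < Q → S ⊈ S' → S' ⊈ S →
    ∑ (vectors Q n) (λ a → hasSum-pair a S c S' c') * (Q * Q) ≡ Q ^ n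
  count-hasSum-pair (suc n) (true ∷ S) (false ∷ S') c c' c<Q c'<Q _ (there d') =
    count-hasSum-pair-true∷false∷ n S S' c c' c<Q c'<Q (⊈⇒NonEmpty d')
  count-hasSum-pair (suc n) (false ∷ S) (true ∷ S') c c' c<Q c'<Q (there d) _ = trans
    (cong (_* (Q * Q)) (∑-cong (vectors Q (suc n)) (λ a → *-comm (hasSum a (false ∷ S) c) _)))
    (count-hasSum-pair-true∷false∷ n S' S c' c c'<Q c<Q (⊈⇒NonEmpty d))
  count-hasSum-pair (suc n) (false ∷ S) (false ∷ S') c c' c<Q c'<Q (there d) (there d') = begin
    ∑ (vectors Q (suc n)) (λ a → hasSum-pair a (false ∷ S) c (false ∷ S') c') * (Q * Q)
      ≡⟨ cong (_* (Q * Q)) (trans (∑-vectors-suc Q n _) (∑-allFin-const Q _)) ⟩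
    Q * ∑ (vectors Q n) (λ a → hasSum-pair a S c S' c') * (Q * Q)
      ≡⟨ *-assoc Q _ _ ⟩
    Q * (∑ (vectors Q n) (λ a → hasSum-pair a S c S' c') * (Q * Q))
      ≡⟨ cong (Q *_) (count-hasSum-pair n S S' c c' c<Q c'<Q d d') ⟩
    Q ^ suc n ∎
    where open ≡-Reasoning
  count-hasSum-pair (suc n) (true ∷ S) (true ∷ S') c c' c<Q c'<Q (there d) (there d') = begin
    ∑ (vectors Q (suc n)) (λ a → hasSum-pair a (true ∷ S) c (true ∷ S') c') * (Q * Q)
      ≡⟨ cong (_* (Q * Q)) (∑-vectors-suc Q n _) ⟩
    ∑ (allFin Q) (λ x → ∑ (vectors Q n) (λ a → hasSum-pair (x ∷ a) (true ∷ S) c (true ∷ S') c')) * (Q * Q)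
      ≡⟨ cong (_* (Q * Q)) (∑-cong (allFin Q) (λ x → ∑-cong (vectors Q n) (λ a →
           cong₂ _*_ (hasSum-true∷ x a S c c<Q) (hasSum-true∷ x a S' c' c'<Q)))) ⟩
    ∑ (allFin Q) (λ x → ∑ (vectors Q n) (λ a → hasSum-pair a S (c -ₘ′ x) S' (c' -ₘ′ x))) * (Q * Q)
      ≡⟨ ∑-*ʳ (allFin Q) (Q * Q) _ ⟨
    ∑ (allFin Q) (λ x → ∑ (vectors Q n) (λ a → hasSum-pair a S (c -ₘ′ x) S' (c' -ₘ′ x)) * (Q * Q))
      ≡⟨ ∑-cong (allFin Q) (λ x → count-hasSum-pair n S S' _ _ (-ₘ<n Q c (toℕ x)) (-ₘ<n Q c' (toℕ x)) d d') ⟩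
    ∑ (allFin Q) (λ x → Q ^ n)
      ≡⟨ ∑-allFin-const Q _ ⟩
    Q ^ suc n ∎
    where
    open ≡-Reasoning
    _-ₘ′_ : ℕ → Fin Q → ℕ
    e -ₘ′ x = _-ₘ_ Q e (toℕ x)

∑-subsets-suc : ∀ n (f : Subset (suc n) → ℕ) →
  ∑ (subsets (suc n)) f ≡ ∑ (subsets n) (λ S → f (true ∷ S)) + ∑ (subsets n) (λ S → f (false ∷ S))
∑-subsets-suc n f = trans (∑-++ (map (true ∷_) (subsets n)) _ f) (cong₂ _+_ (∑-map _ (subsets n) f) (∑-map _ (subsets n) f))

count-subsets-of-size : ∀ n k → ∑ (subsets n) (λ S → ⟦ ∣ S ∣ ≡ᵇ k ⟧) ≡ n C k
count-subsets-of-size zero zero = refl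
count-subsets-of-size zero (suc k) = refl
count-subsets-of-size (suc n) zero =
  trans (∑-subsets-suc n _) (cong₂ _+_ (∑-cong-zero (subsets n) (λ _ → refl)) (count-subsets-of-size n 0))
count-subsets-of-size (suc n) (suc k) = begin
  ∑ (subsets (suc n)) (λ S → ⟦ ∣ S ∣ ≡ᵇ suc k ⟧) ≡⟨ ∑-subsets-suc n _ ⟩
  ∑ (subsets n) (λ S → ⟦ ∣ S ∣ ≡ᵇ k ⟧) + ∑ (subsets n) (λ S → ⟦ ∣ S ∣ ≡ᵇ suc k ⟧)
    ≡⟨ cong₂ _+_ (count-subsets-of-size n k) (count-subsets-of-size n (suc k)) ⟩
  n C k + n C suc k                              ≡⟨ nCk+nC[k+1]≡[n+1]C[k+1] n k ⟩
  suc n C suc k                                  ∎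
  where open ≡-Reasoning

count-subsets-of-size-containing : ∀ n k (i : Fin (suc n)) →
  ∑ (subsets (suc n)) (λ S → ⟦ ∣ S ∣ ≡ᵇ suc k ⟧ * ⟦ lookup S i ⟧) ≡ n C k
count-subsets-of-size-containing n k zero = begin
  ∑ (subsets (suc n)) (λ S → ⟦ ∣ S ∣ ≡ᵇ suc k ⟧ * ⟦ lookup S zero ⟧)
    ≡⟨ ∑-subsets-suc n _ ⟩
  ∑ (subsets n) (λ S → ⟦ ∣ S ∣ ≡ᵇ k ⟧ * 1) + ∑ (subsets n) (λ S → ⟦ ∣ S ∣ ≡ᵇ suc k ⟧ * 0)
    ≡⟨ cong₂ _+_ (∑-cong (subsets n) (λ S → *-identityʳ _)) (∑-cong-zero (subsets n) (λ S → *-zeroʳ ⟦ ∣ S ∣ ≡ᵇ suc k ⟧)) ⟩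
  ∑ (subsets n) (λ S → ⟦ ∣ S ∣ ≡ᵇ k ⟧) + 0
    ≡⟨ trans (+-identityʳ _) (count-subsets-of-size n k) ⟩
  n C k ∎
  where open ≡-Reasoning
count-subsets-of-size-containing (suc n) zero (suc i) =
  trans (∑-subsets-suc (suc n) _) (cong₂ _+_ no-size-0 (count-subsets-of-size-containing n 0 i))
  where
  no-size-0 : ∑ (subsets (suc n)) (λ S → ⟦ ∣ S ∣ ≡ᵇ 0 ⟧ * ⟦ lookup S i ⟧) ≡ 0
  no-size-0 = ∑-cong-zero (subsets (suc n)) (λ S → ∈⇒size≢0 S i)
    where
    ∈⇒size≢0 : ∀ {m} (S : Subset m) i → ⟦ ∣ S ∣ ≡ᵇ 0 ⟧ * ⟦ lookup S i ⟧ ≡ 0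
    ∈⇒size≢0 (true ∷ S) zero = refl
    ∈⇒size≢0 (false ∷ S) zero = *-zeroʳ ⟦ ∣ S ∣ ≡ᵇ 0 ⟧
    ∈⇒size≢0 (true ∷ S) (suc i) = refl
    ∈⇒size≢0 (false ∷ S) (suc i) = ∈⇒size≢0 S i
count-subsets-of-size-containing (suc n) (suc k) (suc i) = trans (∑-subsets-suc (suc n) _) (trans
  (cong₂ _+_ (count-subsets-of-size-containing n k i) (count-subsets-of-size-containing n (suc k) i))
  (nCk+nC[k+1]≡[n+1]C[k+1] n k))

_==ˢ_ : ∀ {n} → Subset n → Subset n → Bool
[] ==ˢ [] = true
(true ∷ S) ==ˢ (true ∷ S') = S ==ˢ S'
(false ∷ S) ==ˢ (false ∷ S') = S ==ˢ S'
(true ∷ S) ==ˢ (false ∷ S') = false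
(false ∷ S) ==ˢ (true ∷ S') = false

==ˢ-refl : ∀ {n} (S : Subset n) → (S ==ˢ S) ≡ true
==ˢ-refl [] = refl
==ˢ-refl (true ∷ S) = ==ˢ-refl S
==ˢ-refl (false ∷ S) = ==ˢ-refl S

==ˢ⇒≡ : ∀ {n} (S S' : Subset n) → (S ==ˢ S') ≡ true → S ≡ S'
==ˢ⇒≡ [] [] _ = refl
==ˢ⇒≡ (true ∷ S) (true ∷ S') e = cong (true ∷_) (==ˢ⇒≡ S S' e)
==ˢ⇒≡ (false ∷ S) (false ∷ S') e = cong (false ∷_) (==ˢ⇒≡ S S' e)

count-==ˢ : ∀ n (S : Subset n) → ∑ (subsets n) (λ S' → ⟦ S' ==ˢ S ⟧) ≡ 1
count-==ˢ zero [] = refl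
count-==ˢ (suc n) (true ∷ S) =
  trans (∑-subsets-suc n _) (cong₂ _+_ (count-==ˢ n S) (∑-cong-zero (subsets n) (λ _ → refl)))
count-==ˢ (suc n) (false ∷ S) =
  trans (∑-subsets-suc n _) (cong₂ _+_ (∑-cong-zero (subsets n) (λ _ → refl)) (count-==ˢ n S))

_⊈?_ : ∀ {n} (S S' : Subset n) → Dec (S ⊈ S')
[] ⊈? [] = no (λ ())
(true ∷ S) ⊈? (false ∷ S') = yes here
(true ∷ S) ⊈? (true ∷ S') with S ⊈? S'
... | yes d = yes (there d)
... | no ¬d = no λ { (there d) → ¬d d }
(false ∷ S) ⊈? (b ∷ S') with S ⊈? S'
... | yes d = yes (there d)
... | no ¬d = no λ { (there d) → ¬d d }

¬⊈⇒∣∣≤ : ∀ {n} (S S' : Subset n) → ¬ S ⊈ S' → ∣ S ∣ ≤ ∣ S' ∣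
¬⊈⇒∣∣≤ [] [] _ = z≤n
¬⊈⇒∣∣≤ (true ∷ S) (true ∷ S') nd = s≤s (¬⊈⇒∣∣≤ S S' (nd ∘ there))
¬⊈⇒∣∣≤ (true ∷ S) (false ∷ S') nd = ⊥-elim (nd here)
¬⊈⇒∣∣≤ (false ∷ S) (true ∷ S') nd = m≤n⇒m≤1+n (¬⊈⇒∣∣≤ S S' (nd ∘ there))
¬⊈⇒∣∣≤ (false ∷ S) (false ∷ S') nd = ¬⊈⇒∣∣≤ S S' (nd ∘ there)

¬⊈⇒≡ : ∀ {n} (S S' : Subset n) → ∣ S ∣ ≡ ∣ S' ∣ → ¬ S ⊈ S' → S ≡ S'
¬⊈⇒≡ [] [] _ _ = refl
¬⊈⇒≡ (true ∷ S) (true ∷ S') e nd = cong (true ∷_) (¬⊈⇒≡ S S' (suc-injective e) (nd ∘ there))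
¬⊈⇒≡ (true ∷ S) (false ∷ S') e nd = ⊥-elim (nd here)
¬⊈⇒≡ (false ∷ S) (true ∷ S') e nd = ⊥-elim (<-irrefl e (s≤s (¬⊈⇒∣∣≤ S S' (nd ∘ there))))
¬⊈⇒≡ (false ∷ S) (false ∷ S') e nd = cong (false ∷_) (¬⊈⇒≡ S S' e (nd ∘ there))

distinct-same-size⇒⊈ : ∀ {n} (S S' : Subset n) → ∣ S ∣ ≡ ∣ S' ∣ → (S' ==ˢ S) ≡ false → S ⊈ S' × S' ⊈ S
distinct-same-size⇒⊈ S S' e ne with S ⊈? S' | S' ⊈? S
... | yes d | yes d' = d , d'
... | no nd | _ = ⊥-elim (false≢true (trans (sym ne) (trans (cong (S' ==ˢ_) (¬⊈⇒≡ S S' e nd)) (==ˢ-refl S'))))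
... | yes _ | no nd = ⊥-elim (false≢true (trans (sym ne) (trans (cong (_==ˢ S) (¬⊈⇒≡ S' S (sym e) nd)) (==ˢ-refl S))))

∣m-n∣²+2mn≡m²+n² : ∀ m n → ∣ m - n ∣ * ∣ m - n ∣ + 2 * (m * n) ≡ m * m + n * n
∣m-n∣²+2mn≡m²+n² m n with ≤-total m n
... | inj₁ m≤n with o , refl ← m≤n⇒∃[o]m+o≡n m≤n =
  trans (cong (λ d → d * d + 2 * (m * (m + o))) (∣m-m+n∣≡n m o)) (square-identity m o)
  where
  square-identity : ∀ m o → o * o + 2 * (m * (m + o)) ≡ m * m + (m + o) * (m + o)
  square-identity = solve-∀
... | inj₂ n≤m with o , refl ← m≤n⇒∃[o]m+o≡n n≤m =
  trans (cong (λ d → d * d + 2 * ((n + o) * n)) (trans (∣-∣-comm (n + o) n) (∣m-m+n∣≡n n o))) (square-identity n o)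
  where
  square-identity : ∀ n o → o * o + 2 * ((n + o) * n) ≡ (n + o) * (n + o) + n * n
  square-identity = solve-∀

-- true iff x ∉ [(1 - p/q) K, (1 + p/q) K]
deviatesᵇ : ℕ → ℕ → ℕ → ℕ → Bool
deviatesᵇ p q K x = not (((q ∸ p) * K ≤ᵇ q * x) ∧ (q * x ≤ᵇ (q + p) * K))

¬deviates⇒bounds : ∀ p q K x → deviatesᵇ p q K x ≡ false → ((q ∸ p) * K ≤ q * x) × (q * x ≤ (q + p) * K)
¬deviates⇒bounds p q K x e with (q ∸ p) * K ≤ᵇ q * x in e₁ | q * x ≤ᵇ (q + p) * K in e₂
... | true | true = ≤ᵇ⇒≤ _ _ (subst T (sym e₁) tt) , ≤ᵇ⇒≤ _ _ (subst T (sym e₂) tt)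

≤ᵇ≡false⇒> : ∀ m n → (m ≤ᵇ n) ≡ false → n < m
≤ᵇ≡false⇒> m n e = ≰⇒> (λ le → subst T e (≤⇒≤ᵇ le))

deviates⇒≤∣x-K∣ : ∀ p q K x → p ≤ q → deviatesᵇ p q K x ≡ true → p * K ≤ q * ∣ x - K ∣
deviates⇒≤∣x-K∣ p q K x p≤q e with (q ∸ p) * K ≤ᵇ q * x in e₁ | q * x ≤ᵇ (q + p) * K in e₂
... | false | _ = begin
  p * K         ≤⟨ m+n≤o⇒m≤o∸n (p * K) pK+qx≤qK ⟩
  q * K ∸ q * x ≡⟨ *-distribˡ-∸ q K x ⟨
  q * (K ∸ x)   ≤⟨ *-monoʳ-≤ q (subst (K ∸ x ≤_) (∣-∣-comm K x) (m∸n≤∣m-n∣ K x)) ⟩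
  q * ∣ x - K ∣ ∎
  where
  open ≤-Reasoning
  pK+qx≤qK : p * K + q * x ≤ q * K
  pK+qx≤qK = begin
    p * K + q * x       ≤⟨ +-monoʳ-≤ (p * K) (<⇒≤ (≤ᵇ≡false⇒> _ _ e₁)) ⟩
    p * K + (q ∸ p) * K ≡⟨ *-distribʳ-+ K p (q ∸ p) ⟨
    (p + (q ∸ p)) * K   ≡⟨ cong (_* K) (m+[n∸m]≡n p≤q) ⟩
    q * K               ∎
... | true | false = begin
  p * K         ≤⟨ m+n≤o⇒m≤o∸n (p * K) pK+qK≤qx ⟩
  q * x ∸ q * K ≡⟨ *-distribˡ-∸ q x K ⟨
  q * (x ∸ K)   ≤⟨ *-monoʳ-≤ q (m∸n≤∣m-n∣ x K) ⟩
  q * ∣ x - K ∣ ∎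
  where
  open ≤-Reasoning
  pK+qK≤qx : p * K + q * K ≤ q * x
  pK+qK≤qx = subst (_≤ q * x) (trans (*-distribʳ-+ K q p) (+-comm (q * K) (p * K))) (<⇒≤ (≤ᵇ≡false⇒> _ _ e₂))

deviates-chebyshev : ∀ p q K x → p ≤ q → ⟦ deviatesᵇ p q K x ⟧ * ((p * K) * (p * K)) ≤ (q * q) * (∣ x - K ∣ * ∣ x - K ∣)
deviates-chebyshev p q K x p≤q with deviatesᵇ p q K x in e
... | false = z≤n
... | true = subst₂ _≤_ (sym (*-identityˡ _)) (square-*-distrib q ∣ x - K ∣) (*-mono-≤ pK≤ pK≤)
  where
  pK≤ : p * K ≤ q * ∣ x - K ∣
  pK≤ = deviates⇒≤∣x-K∣ p q K x p≤q e
  square-*-distrib : ∀ a b → (a * b) * (a * b) ≡ (a * a) * (b * b)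
  square-*-distrib = solve-∀

module Moments (Q : ℕ) .{{_ : NonZero Q}} (M t : ℕ) (i : Fin M) (c : ℕ) (c<Q : c < Q) where

  candidate : Subset M → ℕ
  candidate S = ⟦ ∣ S ∣ ≡ᵇ t ⟧ * ⟦ lookup S i ⟧

  K : ℕ
  K = ∑ (subsets M) candidate

  N : Vec (Fin Q) M → ℕ
  N a = ∑ (subsets M) (λ S → candidate S * hasSum Q a S c)

  candidate-cong : ∀ S {X Y : ℕ} → (lookup S i ≡ true → ∣ S ∣ ≡ t → X ≡ Y) → candidate S * X ≡ candidate S * Y
  candidate-cong S {X} {Y} X≡Y = by-cases (∣ S ∣ ≡ᵇ t) (lookup S i) refl refl
    where
    by-cases : ∀ b b' → (∣ S ∣ ≡ᵇ t) ≡ b → lookup S i ≡ b' → ⟦ b ⟧ * ⟦ b' ⟧ * X ≡ ⟦ b ⟧ * ⟦ b' ⟧ * Y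
    by-cases true true e₁ e₂ = cong (1 *_) (X≡Y e₂ (≡ᵇ⇒≡ _ _ (subst T (sym e₁) tt)))
    by-cases true false e₁ e₂ = refl
    by-cases false _ e₁ e₂ = refl

  solutions : Subset M → ℕ
  solutions S = ∑ (vectors Q M) (λ a → hasSum Q a S c)

  joint : Subset M → Subset M → ℕ
  joint S S' = ∑ (vectors Q M) (λ a → hasSum-pair Q a S c S' c)

  first-moment : Q * ∑ (vectors Q M) N ≡ K * Q ^ M
  first-moment = begin
    Q * ∑ (vectors Q M) N
      ≡⟨ cong (Q *_) (∑-comm (vectors Q M) (subsets M) _) ⟩
    Q * ∑ (subsets M) (λ S → ∑ (vectors Q M) (λ a → candidate S * hasSum Q a S c))
      ≡⟨ cong (Q *_) (∑-cong (subsets M) (λ S → ∑-*ˡ (vectors Q M) (candidate S) _)) ⟩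
    Q * ∑ (subsets M) (λ S → candidate S * solutions S)
      ≡⟨ ∑-*ˡ (subsets M) Q _ ⟨
    ∑ (subsets M) (λ S → Q * (candidate S * solutions S))
      ≡⟨ ∑-cong (subsets M) (λ S → x∙yz≈y∙zx Q (candidate S) (solutions S)) ⟩
    ∑ (subsets M) (λ S → candidate S * (solutions S * Q))
      ≡⟨ ∑-cong (subsets M) (λ S → candidate-cong S (λ i∈S _ → count-hasSum Q M S c c<Q (∈⇒NonEmpty S i i∈S))) ⟩
    ∑ (subsets M) (λ S → candidate S * Q ^ M)
      ≡⟨ ∑-*ʳ (subsets M) (Q ^ M) candidate ⟩
    K * Q ^ M ∎
    where
    open ≡-Reasoning
    x∙yz≈y∙zx : ∀ x y z → x * (y * z) ≡ y * (z * x)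
    x∙yz≈y∙zx = solve-∀

  ∑N² : ∑ (vectors Q M) (λ a → N a * N a) ≡ ∑ (subsets M) (λ S → candidate S * ∑ (subsets M) (λ S' → candidate S' * joint S S'))
  ∑N² = begin
    ∑ (vectors Q M) (λ a → N a * N a)
      ≡⟨ ∑-cong (vectors Q M) (λ a → ∑-square (subsets M) (λ S → candidate S * hasSum Q a S c)) ⟩
    ∑ (vectors Q M) (λ a → ∑ (subsets M) (λ S → ∑ (subsets M) (λ S' → term a S S')))
      ≡⟨ ∑-comm (vectors Q M) (subsets M) _ ⟩
    ∑ (subsets M) (λ S → ∑ (vectors Q M) (λ a → ∑ (subsets M) (λ S' → term a S S')))
      ≡⟨ ∑-cong (subsets M) (λ S → ∑-comm (vectors Q M) (subsets M) _) ⟩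
    ∑ (subsets M) (λ S → ∑ (subsets M) (λ S' → ∑ (vectors Q M) (λ a → term a S S')))
      ≡⟨ ∑-cong (subsets M) (λ S → ∑-cong (subsets M) (λ S' → pull-out S S')) ⟩
    ∑ (subsets M) (λ S → ∑ (subsets M) (λ S' → candidate S * (candidate S' * joint S S')))
      ≡⟨ ∑-cong (subsets M) (λ S → ∑-*ˡ (subsets M) (candidate S) _) ⟩
    ∑ (subsets M) (λ S → candidate S * ∑ (subsets M) (λ S' → candidate S' * joint S S')) ∎
    where
    open ≡-Reasoning
    term : Vec (Fin Q) M → Subset M → Subset M → ℕ
    term a S S' = (candidate S * hasSum Q a S c) * (candidate S' * hasSum Q a S' c)
    rearrange : ∀ a b c d → (a * b) * (c * d) ≡ a * (c * (b * d))
    rearrange = solve-∀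
    pull-out : ∀ S S' → ∑ (vectors Q M) (λ a → term a S S') ≡ candidate S * (candidate S' * joint S S')
    pull-out S S' = trans (∑-cong (vectors Q M) (λ a → rearrange (candidate S) _ (candidate S') _))
      (trans (∑-*ˡ (vectors Q M) (candidate S) _) (cong (candidate S *_) (∑-*ˡ (vectors Q M) (candidate S') _)))

  -- A candidate S' pairs independently with S unless S' = S, where the two events coincide.
  joint-term : ∀ S → lookup S i ≡ true → ∣ S ∣ ≡ t → ∀ S' →
    candidate S' * (joint S S' * (Q * Q)) + ⟦ S' ==ˢ S ⟧ * Q ^ M ≡ candidate S' * Q ^ M + ⟦ S' ==ˢ S ⟧ * Q ^ suc M
  joint-term S i∈S ∣S∣≡t S' with S' ==ˢ S in same
  ... | true rewrite ==ˢ⇒≡ S' S same = begin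
      candidate S * (joint S S * (Q * Q)) + 1 * Q ^ M
        ≡⟨ cong (λ u → candidate S * u + 1 * Q ^ M) diagonal ⟩
      candidate S * (Q ^ M * Q) + 1 * Q ^ M
        ≡⟨ cong (λ u → u * (Q ^ M * Q) + 1 * Q ^ M) candidate-S ⟩
      1 * (Q ^ M * Q) + 1 * Q ^ M
        ≡⟨ swap (Q ^ M) Q ⟩
      1 * Q ^ M + 1 * (Q * Q ^ M)
        ≡⟨ cong (λ u → u * Q ^ M + 1 * Q ^ suc M) candidate-S ⟨
      candidate S * Q ^ M + 1 * Q ^ suc M ∎
    where
    open ≡-Reasoning
    swap : ∀ x q → 1 * (x * q) + 1 * x ≡ 1 * x + 1 * (q * x)
    swap = solve-∀
    candidate-S : candidate S ≡ 1
    candidate-S = cong₂ (λ u v → ⟦ u ⟧ * ⟦ v ⟧) (≡⇒≡ᵇ-true ∣S∣≡t) i∈S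
      where
      ≡⇒≡ᵇ-true : ∀ {m n} → m ≡ n → (m ≡ᵇ n) ≡ true
      ≡⇒≡ᵇ-true {m} refl = T⇒≡true (≡⇒≡ᵇ m m refl)
    diagonal : joint S S * (Q * Q) ≡ Q ^ M * Q
    diagonal = begin
      joint S S * (Q * Q)  ≡⟨ cong (_* (Q * Q)) (∑-cong (vectors Q M) (λ a → ⟦⟧-idem _)) ⟩
      solutions S * (Q * Q) ≡⟨ *-assoc (solutions S) Q Q ⟨
      solutions S * Q * Q   ≡⟨ cong (_* Q) (count-hasSum Q M S c c<Q (∈⇒NonEmpty S i i∈S)) ⟩
      Q ^ M * Q             ∎
  ... | false = cong (_+ 0) (candidate-cong S' (λ _ ∣S'∣≡t →
      let S⊈S' , S'⊈S = distinct-same-size⇒⊈ S S' (trans ∣S∣≡t (sym ∣S'∣≡t)) same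
      in count-hasSum-pair Q M S S' c c c<Q c<Q S⊈S' S'⊈S))

  row : Subset M → ℕ
  row S = ∑ (subsets M) (λ S' → candidate S' * (joint S S' * (Q * Q)))

  row-sum : ∀ S → candidate S * (row S + Q ^ M) ≡ candidate S * (K * Q ^ M + Q ^ suc M)
  row-sum S = candidate-cong S λ i∈S ∣S∣≡t → begin
    row S + Q ^ M
      ≡⟨ cong (row S +_) (sym (trans (cong (_* Q ^ M) (count-==ˢ M S)) (+-identityʳ _))) ⟩
    row S + ∑ (subsets M) (λ S' → ⟦ S' ==ˢ S ⟧) * Q ^ M
      ≡⟨ cong (row S +_) (∑-*ʳ (subsets M) (Q ^ M) _) ⟨
    row S + ∑ (subsets M) (λ S' → ⟦ S' ==ˢ S ⟧ * Q ^ M)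
      ≡⟨ ∑-distrib-+ (subsets M) _ _ ⟨
    ∑ (subsets M) (λ S' → candidate S' * (joint S S' * (Q * Q)) + ⟦ S' ==ˢ S ⟧ * Q ^ M)
      ≡⟨ ∑-cong (subsets M) (joint-term S i∈S ∣S∣≡t) ⟩
    ∑ (subsets M) (λ S' → candidate S' * Q ^ M + ⟦ S' ==ˢ S ⟧ * Q ^ suc M)
      ≡⟨ ∑-distrib-+ (subsets M) _ _ ⟩
    ∑ (subsets M) (λ S' → candidate S' * Q ^ M) + ∑ (subsets M) (λ S' → ⟦ S' ==ˢ S ⟧ * Q ^ suc M)
      ≡⟨ cong₂ _+_ (∑-*ʳ (subsets M) (Q ^ M) candidate)
           (trans (∑-*ʳ (subsets M) (Q ^ suc M) _) (trans (cong (_* Q ^ suc M) (count-==ˢ M S)) (+-identityʳ _))) ⟩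
    K * Q ^ M + Q ^ suc M ∎
    where open ≡-Reasoning

  second-moment : Q * Q * ∑ (vectors Q M) (λ a → N a * N a) + K * Q ^ M ≡ K * (K * Q ^ M + Q ^ suc M)
  second-moment = begin
    Q * Q * ∑ (vectors Q M) (λ a → N a * N a) + K * Q ^ M
      ≡⟨ cong (λ u → Q * Q * u + K * Q ^ M) ∑N² ⟩
    Q * Q * ∑ (subsets M) (λ S → candidate S * ∑ (subsets M) (λ S' → candidate S' * joint S S')) + K * Q ^ M
      ≡⟨ cong₂ _+_ scale (∑-*ʳ (subsets M) (Q ^ M) candidate) ⟨
    ∑ (subsets M) (λ S → candidate S * row S) + ∑ (subsets M) (λ S → candidate S * Q ^ M)
      ≡⟨ ∑-distrib-+ (subsets M) _ _ ⟨
    ∑ (subsets M) (λ S → candidate S * row S + candidate S * Q ^ M)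
      ≡⟨ ∑-cong (subsets M) (λ S → trans (sym (*-distribˡ-+ (candidate S) (row S) (Q ^ M))) (row-sum S)) ⟩
    ∑ (subsets M) (λ S → candidate S * (K * Q ^ M + Q ^ suc M))
      ≡⟨ ∑-*ʳ (subsets M) _ candidate ⟩
    K * (K * Q ^ M + Q ^ suc M) ∎
    where
    open ≡-Reasoning
    x∙yz≈y∙xz : ∀ x y z → x * (y * z) ≡ y * (x * z)
    x∙yz≈y∙xz = solve-∀
    x∙yz≈y∙zx : ∀ x y z → x * (y * z) ≡ y * (z * x)
    x∙yz≈y∙zx = solve-∀
    scale : ∑ (subsets M) (λ S → candidate S * row S)
          ≡ Q * Q * ∑ (subsets M) (λ S → candidate S * ∑ (subsets M) (λ S' → candidate S' * joint S S'))
    scale = sym (trans (sym (∑-*ˡ (subsets M) (Q * Q) _)) (∑-cong (subsets M) (λ S →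
      trans (x∙yz≈y∙xz (Q * Q) (candidate S) _) (cong (candidate S *_)
        (trans (sym (∑-*ˡ (subsets M) (Q * Q) _)) (∑-cong (subsets M) (λ S' → x∙yz≈y∙zx (Q * Q) (candidate S') (joint S S'))))))))

  variance : ℕ
  variance = ∑ (vectors Q M) (λ a → ∣ Q * N a - K ∣ * ∣ Q * N a - K ∣)

  variance-expansion : variance + 2 * ((K * Q ^ M) * K) ≡ Q * Q * ∑ (vectors Q M) (λ a → N a * N a) + Q ^ M * (K * K)
  variance-expansion = begin
    variance + 2 * ((K * Q ^ M) * K)
      ≡⟨ cong (λ u → variance + 2 * (u * K)) first-moment ⟨
    variance + 2 * ((Q * ∑ (vectors Q M) N) * K)
      ≡⟨ cong (λ u → variance + 2 * u) (trans (∑-*ʳ (vectors Q M) K _) (cong (_* K) (∑-*ˡ (vectors Q M) Q N))) ⟨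
    variance + 2 * ∑ (vectors Q M) (λ a → (Q * N a) * K)
      ≡⟨ cong (variance +_) (∑-*ˡ (vectors Q M) 2 _) ⟨
    variance + ∑ (vectors Q M) (λ a → 2 * ((Q * N a) * K))
      ≡⟨ ∑-distrib-+ (vectors Q M) _ _ ⟨
    ∑ (vectors Q M) (λ a → ∣ Q * N a - K ∣ * ∣ Q * N a - K ∣ + 2 * ((Q * N a) * K))
      ≡⟨ ∑-cong (vectors Q M) (λ a → ∣m-n∣²+2mn≡m²+n² (Q * N a) K) ⟩
    ∑ (vectors Q M) (λ a → (Q * N a) * (Q * N a) + K * K)
      ≡⟨ ∑-distrib-+ (vectors Q M) _ _ ⟩
    ∑ (vectors Q M) (λ a → (Q * N a) * (Q * N a)) + ∑ (vectors Q M) (λ a → K * K)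
      ≡⟨ cong₂ _+_ (trans (∑-cong (vectors Q M) (λ a → square-*-distrib Q (N a))) (∑-*ˡ (vectors Q M) (Q * Q) _))
                   (∑-vectors-const Q M (K * K)) ⟩
    Q * Q * ∑ (vectors Q M) (λ a → N a * N a) + Q ^ M * (K * K) ∎
    where
    open ≡-Reasoning
    square-*-distrib : ∀ q n → (q * n) * (q * n) ≡ q * q * (n * n)
    square-*-distrib = solve-∀

  variance≡ : variance + K * Q ^ M ≡ K * Q ^ suc M
  variance≡ = cancel variance _ K (Q ^ M) (Q ^ suc M) variance-expansion second-moment
    where
    open ≡-Reasoning
    cancel : ∀ v x k p p' → v + 2 * ((k * p) * k) ≡ x + p * (k * k) → x + k * p ≡ k * (k * p + p') → v + k * p ≡ k * p'
    cancel v x k p p' e₁ e₂ = +-cancelʳ-≡ (2 * ((k * p) * k)) _ _ (begin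
      (v + k * p) + 2 * ((k * p) * k)    ≡⟨ r₁ v k p ⟩
      (v + 2 * ((k * p) * k)) + k * p    ≡⟨ cong (_+ k * p) e₁ ⟩
      (x + p * (k * k)) + k * p          ≡⟨ r₂ x k p ⟩
      (x + k * p) + p * (k * k)          ≡⟨ cong (_+ p * (k * k)) e₂ ⟩
      k * (k * p + p') + p * (k * k)     ≡⟨ r₃ k p p' ⟩
      k * p' + 2 * ((k * p) * k)         ∎)
      where
      r₁ : ∀ v k p → (v + k * p) + 2 * ((k * p) * k) ≡ (v + 2 * ((k * p) * k)) + k * p
      r₁ = solve-∀
      r₂ : ∀ x k p → (x + p * (k * k)) + k * p ≡ (x + k * p) + p * (k * k)
      r₂ = solve-∀
      r₃ : ∀ k p p' → k * (k * p + p') + p * (k * k) ≡ k * p' + 2 * ((k * p) * k)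
      r₃ = solve-∀

  chebyshev : ∀ p q → p ≤ q → 0 < K →
    ∑ (vectors Q M) (λ a → ⟦ deviatesᵇ p q K (Q * N a) ⟧) * (p * p * K) ≤ q * q * Q ^ suc M
  chebyshev p q p≤q K>0 = *-cancelʳ-≤ _ _ K {{ℕ.>-nonZero K>0}} (begin
    #deviating * (p * p * K) * K
      ≡⟨ trans (regroup #deviating p K) (sym (∑-*ʳ (vectors Q M) ((p * K) * (p * K)) _)) ⟩
    ∑ (vectors Q M) (λ a → ⟦ deviatesᵇ p q K (Q * N a) ⟧ * ((p * K) * (p * K)))
      ≤⟨ ∑-mono-≤ (vectors Q M) (λ a → deviates-chebyshev p q K (Q * N a) p≤q) ⟩
    ∑ (vectors Q M) (λ a → (q * q) * (∣ Q * N a - K ∣ * ∣ Q * N a - K ∣))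
      ≡⟨ ∑-*ˡ (vectors Q M) (q * q) _ ⟩
    q * q * variance
      ≤⟨ *-monoʳ-≤ (q * q) (subst (variance ≤_) variance≡ (m≤m+n variance _)) ⟩
    q * q * (K * Q ^ suc M)
      ≡⟨ x∙yz≈xz∙y (q * q) K (Q ^ suc M) ⟩
    q * q * Q ^ suc M * K ∎)
    where
    open ≤-Reasoning
    #deviating = ∑ (vectors Q M) (λ a → ⟦ deviatesᵇ p q K (Q * N a) ⟧)
    regroup : ∀ s p K → s * (p * p * K) * K ≡ s * ((p * K) * (p * K))
    regroup = solve-∀
    x∙yz≈xz∙y : ∀ x y z → x * (y * z) ≡ x * z * y
    x∙yz≈xz∙y = solve-∀

⟦not-∧⟧≤ : ∀ x y → ⟦ not (x ∧ y) ⟧ ≤ ⟦ not x ⟧ + ⟦ not y ⟧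
⟦not-∧⟧≤ true y = ≤-refl
⟦not-∧⟧≤ false y = s≤s z≤n

⟦not-∧∧∧⟧≤ : ∀ a b c d → ⟦ not ((a ∧ b) ∧ (c ∧ d)) ⟧ ≤ ⟦ not c ⟧ + ⟦ not a ⟧ + ⟦ not (b ∧ d) ⟧
⟦not-∧∧∧⟧≤ true b true d = ≤-refl
⟦not-∧∧∧⟧≤ a b false d = ≤-trans (⟦⟧≤1 _) (m≤m+n 1 _)
⟦not-∧∧∧⟧≤ false b true d = ≤-trans (⟦⟧≤1 _) (m≤m+n 1 _)

#common : ∀ {n} → Subset n → Subset n → ℕ
#common {n} X Y = ∑Fin n (λ i → ⟦ lookup X i ⟧ * ⟦ lookup Y i ⟧)

intersects≤#common : ∀ {n} (X Y : Subset n) → ⟦ not (disjointᵇ X Y) ⟧ ≤ #common X Y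
intersects≤#common [] [] = z≤n
intersects≤#common (true ∷ X) (true ∷ Y) = s≤s z≤n
intersects≤#common (true ∷ X) (false ∷ Y) = intersects≤#common X Y
intersects≤#common (false ∷ X) (true ∷ Y) = intersects≤#common X Y
intersects≤#common (false ∷ X) (false ∷ Y) = intersects≤#common X Y

degree : ∀ {n} → List (Subset n) → Fin n → ℕ
degree L i = ∑ L (λ S → ⟦ lookup S i ⟧)

∑Fin-degree : ∀ {n} t (L : List (Subset n)) → All (λ S → ∣ S ∣ ≡ t) L → ∑Fin n (degree L) ≡ t * length L
∑Fin-degree {n} t L sizes = begin
  ∑Fin n (degree L)                                   ≡⟨ ∑-∑Fin-comm L n (λ S i → ⟦ lookup S i ⟧) ⟨
  ∑ L (λ S → ∑Fin n (λ i → ⟦ lookup S i ⟧))           ≡⟨ ∑-sizes L sizes ⟩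
  ∑ L (λ _ → t)                                       ≡⟨ ∑-const L t ⟩
  length L * t                                        ≡⟨ *-comm (length L) t ⟩
  t * length L                                        ∎
  where
  open ≡-Reasoning
  ∑-sizes : ∀ L' → All (λ S → ∣ S ∣ ≡ t) L' → ∑ L' (λ S → ∑Fin n (λ i → ⟦ lookup S i ⟧)) ≡ ∑ L' (λ _ → t)
  ∑-sizes [] [] = refl
  ∑-sizes (S ∷ L') (e ∷ es) = cong₂ _+_ (trans (sym (∣S∣≡∑Fin S)) e) (∑-sizes L' es)

meets-some≤ : ∀ {n} (S : Subset n) ss → ⟦ not (all (disjointᵇ S) ss) ⟧ ≤ ∑Fin n (λ i → ⟦ lookup S i ⟧ * degree ss i)
meets-some≤ {n} S [] = ≤-reflexive (sym (trans (∑Fin-cong n (λ i → *-zeroʳ ⟦ lookup S i ⟧)) (trans (∑Fin-const n 0) (*-zeroʳ n))))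
meets-some≤ {n} S (S' ∷ ss) = begin
  ⟦ not (disjointᵇ S S' ∧ all (disjointᵇ S) ss) ⟧
    ≤⟨ ⟦not-∧⟧≤ (disjointᵇ S S') (all (disjointᵇ S) ss) ⟩
  ⟦ not (disjointᵇ S S') ⟧ + ⟦ not (all (disjointᵇ S) ss) ⟧
    ≤⟨ +-mono-≤ (intersects≤#common S S') (meets-some≤ S ss) ⟩
  #common S S' + ∑Fin n (λ i → ⟦ lookup S i ⟧ * degree ss i)
    ≡⟨ ∑Fin-distrib-+ n _ _ ⟨
  ∑Fin n (λ i → ⟦ lookup S i ⟧ * ⟦ lookup S' i ⟧ + ⟦ lookup S i ⟧ * degree ss i)
    ≡⟨ ∑Fin-cong n (λ i → *-distribˡ-+ ⟦ lookup S i ⟧ _ _) ⟨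
  ∑Fin n (λ i → ⟦ lookup S i ⟧ * degree (S' ∷ ss) i) ∎
  where open ≤-Reasoning

hit-∷≤ : ∀ {n} (I S : Subset n) ss →
  ⟦ hitᵇ I (S ∷ ss) ⟧ ≤ #common I S + ∑Fin n (λ i → ⟦ lookup S i ⟧ * degree ss i) + ⟦ hitᵇ I ss ⟧
hit-∷≤ I S ss = ≤-trans
  (⟦not-∧∧∧⟧≤ (all (disjointᵇ S) ss) (pairwiseDisjointᵇ ss) (disjointᵇ I S) (all (disjointᵇ I) ss))
  (+-monoˡ-≤ _ (+-mono-≤ (intersects≤#common I S) (meets-some≤ S ss)))

#tuples : {A : Set} → List (List A) → ℕ
#tuples Ls = ∑ (tuples Ls) (λ _ → 1)

#tuples-∷ : {A : Set} (L : List A) (Ls : List (List A)) → #tuples (L ∷ Ls) ≡ length L * #tuples Ls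
#tuples-∷ L Ls = trans (∑-tuples L Ls _) (∑-const L (#tuples Ls))

∑-tuples-const : {A : Set} (Ls : List (List A)) (k : ℕ) → ∑ (tuples Ls) (λ _ → k) ≡ k * #tuples Ls
∑-tuples-const Ls k = trans (∑-cong (tuples Ls) (λ _ → sym (*-identityʳ k))) (∑-*ˡ (tuples Ls) k (λ _ → 1))

#tuples>0 : {A : Set} (Ls : List (List A)) → All (λ L → 0 < length L) Ls → 0 < #tuples Ls
#tuples>0 [] [] = s≤s z≤n
#tuples>0 (L ∷ Ls) (l ∷ ls) = subst (0 <_) (sym (#tuples-∷ L Ls)) (*-mono-≤ l (#tuples>0 Ls ls))

module Hitting (n t A B : ℕ) where

  Balanced : List (Subset n) → Set
  Balanced L = ∀ i → degree L i * A ≤ B * length L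

  ∑-degree-tuples : ∀ Ls → All Balanced Ls → ∀ i → ∑ (tuples Ls) (λ ss → degree ss i) * A ≤ length Ls * B * #tuples Ls
  ∑-degree-tuples [] [] i = z≤n
  ∑-degree-tuples (L ∷ Ls) (bal ∷ bals) i = begin
    ∑ (tuples (L ∷ Ls)) (λ ss → degree ss i) * A
      ≡⟨ cong (_* A) (∑-tuples L Ls (λ ss → degree ss i)) ⟩
    ∑ L (λ S → ∑ (tuples Ls) (λ ss → ⟦ lookup S i ⟧ + degree ss i)) * A
      ≡⟨ cong (_* A) (∑-cong L (λ S → trans (∑-distrib-+ (tuples Ls) _ _) (cong (_+ O) (∑-tuples-const Ls _)))) ⟩
    ∑ L (λ S → ⟦ lookup S i ⟧ * T' + O) * A
      ≡⟨ cong (_* A) (trans (∑-distrib-+ L _ _) (cong₂ _+_ (∑-*ʳ L T' _) (∑-const L O))) ⟩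
    (degree L i * T' + length L * O) * A
      ≡⟨ distribute (degree L i) T' (length L) O A ⟩
    degree L i * A * T' + length L * (O * A)
      ≤⟨ +-mono-≤ (*-monoˡ-≤ T' (bal i)) (*-monoʳ-≤ (length L) (∑-degree-tuples Ls bals i)) ⟩
    B * length L * T' + length L * (length Ls * B * T')
      ≡⟨ collect B (length L) T' (length Ls) ⟩
    suc (length Ls) * B * (length L * T')
      ≡⟨ cong (suc (length Ls) * B *_) (#tuples-∷ L Ls) ⟨
    suc (length Ls) * B * #tuples (L ∷ Ls) ∎
    where
    open ≤-Reasoning
    T' : ℕ
    T' = #tuples Ls
    O : ℕ
    O = ∑ (tuples Ls) (λ ss → degree ss i)
    distribute : ∀ a b c d e → (a * b + c * d) * e ≡ a * e * b + c * (d * e)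
    distribute = solve-∀
    collect : ∀ B l T k → B * l * T + l * (k * B * T) ≡ (1 + k) * B * (l * T)
    collect = solve-∀

  ∑-#common-bound : ∀ I L → Balanced L → ∑ L (#common I) * A ≤ ∣ I ∣ * (B * length L)
  ∑-#common-bound I L bal =
    subst (λ x → x * A ≤ ∣ I ∣ * (B * length L)) (sym (∑-∑Fin-weighted L I (λ S i → ⟦ lookup S i ⟧)))
    (∑Fin-weighted-bound A I (degree L) _ bal)

  #hitting : Subset n → List (List (Subset n)) → ℕ
  #hitting I Ls = ∑ (tuples Ls) (λ ss → ⟦ hitᵇ I ss ⟧)

  #hitting-∷-bound : ∀ (I S : Subset n) Ls → ∣ S ∣ ≡ t → All Balanced Ls →
    ∑ (tuples Ls) (λ ss → ⟦ hitᵇ I (S ∷ ss) ⟧) * A ≤ #common I S * A * #tuples Ls + t * (length Ls * B * #tuples Ls) + #hitting I Ls * A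
  #hitting-∷-bound I S Ls ∣S∣≡t bals = begin
    ∑ (tuples Ls) (λ ss → ⟦ hitᵇ I (S ∷ ss) ⟧) * A
      ≤⟨ *-monoˡ-≤ A (∑-mono-≤ (tuples Ls) (hit-∷≤ I S)) ⟩
    ∑ (tuples Ls) (λ ss → #common I S + meets ss + ⟦ hitᵇ I ss ⟧) * A
      ≡⟨ cong (_* A) (trans (∑-distrib-+ (tuples Ls) _ _) (cong (_+ #hitting I Ls)
           (trans (∑-distrib-+ (tuples Ls) _ _) (cong (_+ ∑ (tuples Ls) meets) (∑-tuples-const Ls (#common I S)))))) ⟩
    (#common I S * #tuples Ls + ∑ (tuples Ls) meets + #hitting I Ls) * A
      ≡⟨ distribute (#common I S) (#tuples Ls) (∑ (tuples Ls) meets) (#hitting I Ls) A ⟩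
    #common I S * A * #tuples Ls + ∑ (tuples Ls) meets * A + #hitting I Ls * A
      ≤⟨ +-monoˡ-≤ (#hitting I Ls * A) (+-monoʳ-≤ (#common I S * A * #tuples Ls) ∑-meets-bound) ⟩
    #common I S * A * #tuples Ls + t * (length Ls * B * #tuples Ls) + #hitting I Ls * A ∎
    where
    open ≤-Reasoning
    meets : List (Subset n) → ℕ
    meets ss = ∑Fin n (λ i → ⟦ lookup S i ⟧ * degree ss i)
    distribute : ∀ a b c d e → (a * b + c + d) * e ≡ a * e * b + c * e + d * e
    distribute = solve-∀
    ∑-meets-bound : ∑ (tuples Ls) meets * A ≤ t * (length Ls * B * #tuples Ls)
    ∑-meets-bound = subst₂ (λ x y → x * A ≤ y * (length Ls * B * #tuples Ls))
      (sym (∑-∑Fin-weighted (tuples Ls) S (λ ss i → degree ss i))) ∣S∣≡t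
      (∑Fin-weighted-bound A S _ _ (∑-degree-tuples Ls bals))

  #hitting-bound : ∀ (I : Subset n) Ls → All Balanced Ls → All (All (λ S → ∣ S ∣ ≡ t)) Ls →
    #hitting I Ls * A ≤ (∣ I ∣ * length Ls + t * (length Ls * length Ls)) * B * #tuples Ls
  #hitting-bound I [] [] [] = z≤n
  #hitting-bound I (L ∷ Ls) (bal ∷ bals) (sizes ∷ sizess) = begin
    #hitting I (L ∷ Ls) * A
      ≡⟨ cong (_* A) (∑-tuples L Ls _) ⟩
    ∑ L (λ S → ∑ (tuples Ls) (λ ss → ⟦ hitᵇ I (S ∷ ss) ⟧)) * A
      ≡⟨ ∑-*ʳ L A _ ⟨
    ∑ L (λ S → ∑ (tuples Ls) (λ ss → ⟦ hitᵇ I (S ∷ ss) ⟧) * A)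
      ≤⟨ ∑-mono-≤-All L sizes ⟩
    ∑ L (λ S → #common I S * A * T' + t * (k * B * T') + H' * A)
      ≡⟨ trans (∑-distrib-+ L _ _) (cong₂ _+_ (trans (∑-distrib-+ L _ _) (cong₂ _+_ (∑-*ʳ L T' _) (∑-const L _))) (∑-const L _)) ⟩
    ∑ L (λ S → #common I S * A) * T' + length L * (t * (k * B * T')) + length L * (H' * A)
      ≤⟨ +-mono-≤ (+-monoˡ-≤ _ (*-monoˡ-≤ T' (subst (_≤ ∣ I ∣ * (B * length L)) (sym (∑-*ʳ L A _)) (∑-#common-bound I L bal))))
                  (*-monoʳ-≤ (length L) (#hitting-bound I Ls bals sizess)) ⟩
    ∣ I ∣ * (B * length L) * T' + length L * (t * (k * B * T')) + length L * ((∣ I ∣ * k + t * (k * k)) * B * T')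
      ≤⟨ collect ∣ I ∣ B (length L) T' t k ⟩
    (∣ I ∣ * suc k + t * (suc k * suc k)) * B * (length L * T')
      ≡⟨ cong ((∣ I ∣ * suc k + t * (suc k * suc k)) * B *_) (#tuples-∷ L Ls) ⟨
    (∣ I ∣ * suc k + t * (suc k * suc k)) * B * #tuples (L ∷ Ls) ∎
    where
    open ≤-Reasoning
    T' : ℕ
    T' = #tuples Ls
    k : ℕ
    k = length Ls
    H' : ℕ
    H' = #hitting I Ls
    ∑-mono-≤-All : ∀ L' → All (λ S → ∣ S ∣ ≡ t) L' →
      ∑ L' (λ S → ∑ (tuples Ls) (λ ss → ⟦ hitᵇ I (S ∷ ss) ⟧) * A) ≤ ∑ L' (λ S → #common I S * A * T' + t * (k * B * T') + H' * A)
    ∑-mono-≤-All [] [] = z≤n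
    ∑-mono-≤-All (S ∷ L') (e ∷ es) = +-mono-≤ (#hitting-∷-bound I S Ls e bals) (∑-mono-≤-All L' es)
    collect : ∀ v B l T t k → v * (B * l) * T + l * (t * (k * B * T)) + l * ((v * k + t * (k * k)) * B * T)
      ≤ (v * suc k + t * (suc k * suc k)) * B * (l * T)
    collect v B l T t k = ≤-trans (m≤m+n _ (t * suc k * B * (l * T))) (≤-reflexive (expand v B l T t k))
      where
      expand : ∀ v B l T t k → v * (B * l) * T + l * (t * (k * B * T)) + l * ((v * k + t * (k * k)) * B * T) + t * suc k * B * (l * T)
        ≡ (v * suc k + t * (suc k * suc k)) * B * (l * T)
      expand = solve-∀

open ℤ using (+_; -[1+_]; +≤+)

-- r = a / b, stated by cross-multiplication so that no normalisation is involved.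
_≃_/_ : ℚᵘ → ℕ → ℕ → Set
r ≃ a / b = ↥ r ℤ.* + b ≡ + a ℤ.* ↧ r

infix 4 _≃_/_

≃/-* : ∀ r s a b c d → r ≃ a / b → s ≃ c / d → r ℚᵘ.* s ≃ a * c / (b * d)
≃/-* r@(mkℚᵘ x b') s@(mkℚᵘ y d') a b c d e₁ e₂ = begin
  (x ℤ.* y) ℤ.* + (b * d)                   ≡⟨ cong ((x ℤ.* y) ℤ.*_) (ℤP.pos-* b d) ⟩
  (x ℤ.* y) ℤ.* (+ b ℤ.* + d)               ≡⟨ interchange x y (+ b) (+ d) ⟩
  (x ℤ.* + b) ℤ.* (y ℤ.* + d)               ≡⟨ cong₂ ℤ._*_ e₁ e₂ ⟩
  (+ a ℤ.* + suc b') ℤ.* (+ c ℤ.* + suc d') ≡⟨ interchange (+ a) (+ suc b') (+ c) (+ suc d') ⟩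
  (+ a ℤ.* + c) ℤ.* (+ suc b' ℤ.* + suc d') ≡⟨ cong₂ ℤ._*_ (ℤP.pos-* a c) (ℤP.pos-* (suc b') (suc d')) ⟨
  + (a * c) ℤ.* + (suc b' * suc d')         ∎
  where
  open ≡-Reasoning
  interchange : ∀ w x y z → (w ℤ.* x) ℤ.* (y ℤ.* z) ≡ (w ℤ.* y) ℤ.* (x ℤ.* z)
  interchange = solveℤ-∀

≃/-cong : ∀ r s a b → r ℚᵘ.≃ s → s ≃ a / b → r ≃ a / b
≃/-cong r@(mkℚᵘ x r') s@(mkℚᵘ y s') a b (*≡* e) v = ℤP.*-cancelʳ-≡ _ _ (+ suc s') (begin
  x ℤ.* + b ℤ.* + suc s'           ≡⟨ xy∙z≈xz∙y x (+ b) (+ suc s') ⟩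
  (x ℤ.* + suc s') ℤ.* + b         ≡⟨ cong (ℤ._* + b) e ⟩
  (y ℤ.* + suc r') ℤ.* + b         ≡⟨ xy∙z≈xz∙y y (+ suc r') (+ b) ⟩
  (y ℤ.* + b) ℤ.* + suc r'         ≡⟨ cong (ℤ._* + suc r') v ⟩
  (+ a ℤ.* + suc s') ℤ.* + suc r'  ≡⟨ xy∙z≈xz∙y (+ a) (+ suc s') (+ suc r') ⟩
  + a ℤ.* + suc r' ℤ.* + suc s'    ∎)
  where
  open ≡-Reasoning
  xy∙z≈xz∙y : ∀ x y z → (x ℤ.* y) ℤ.* z ≡ (x ℤ.* z) ℤ.* y
  xy∙z≈xz∙y = solveℤ-∀

≃/-≤ : ∀ r s a b' c d' → r ≃ a / suc b' → s ≃ c / suc d' → a * suc d' ≤ c * suc b' → r ℚᵘ.≤ s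
≃/-≤ r@(mkℚᵘ x r') s@(mkℚᵘ y s') a b' c d' e₁ e₂ le = *≤* (ℤP.*-cancelʳ-≤-pos _ _ (+ (suc b' * suc d')) (begin
  x ℤ.* + suc s' ℤ.* + (suc b' * suc d')          ≡⟨ cong (x ℤ.* + suc s' ℤ.*_) (ℤP.pos-* (suc b') (suc d')) ⟩
  x ℤ.* + suc s' ℤ.* (+ suc b' ℤ.* + suc d')      ≡⟨ r₁ x (+ suc s') (+ suc b') (+ suc d') ⟩
  (x ℤ.* + suc b') ℤ.* (+ suc s' ℤ.* + suc d')    ≡⟨ cong (ℤ._* (+ suc s' ℤ.* + suc d')) e₁ ⟩
  (+ a ℤ.* + suc r') ℤ.* (+ suc s' ℤ.* + suc d')  ≡⟨ r₂ (+ a) (+ suc r') (+ suc s') (+ suc d') ⟩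
  (+ a ℤ.* + suc d') ℤ.* (+ suc r' ℤ.* + suc s')  ≡⟨ cong₂ ℤ._*_ (ℤP.pos-* a (suc d')) (ℤP.pos-* (suc r') (suc s')) ⟨
  + (a * suc d') ℤ.* + (suc r' * suc s')          ≤⟨ ℤP.*-monoʳ-≤-nonNeg (+ (suc r' * suc s')) (+≤+ le) ⟩
  + (c * suc b') ℤ.* + (suc r' * suc s')          ≡⟨ cong₂ ℤ._*_ (ℤP.pos-* c (suc b')) (ℤP.pos-* (suc r') (suc s')) ⟩
  (+ c ℤ.* + suc b') ℤ.* (+ suc r' ℤ.* + suc s')  ≡⟨ r₂ (+ c) (+ suc b') (+ suc r') (+ suc s') ⟩
  (+ c ℤ.* + suc s') ℤ.* (+ suc b' ℤ.* + suc r')  ≡⟨ cong (ℤ._* (+ suc b' ℤ.* + suc r')) e₂ ⟨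
  (y ℤ.* + suc d') ℤ.* (+ suc b' ℤ.* + suc r')    ≡⟨ r₃ y (+ suc d') (+ suc b') (+ suc r') ⟩
  y ℤ.* + suc r' ℤ.* (+ suc b' ℤ.* + suc d')      ≡⟨ cong (y ℤ.* + suc r' ℤ.*_) (ℤP.pos-* (suc b') (suc d')) ⟨
  y ℤ.* + suc r' ℤ.* + (suc b' * suc d')          ∎))
  where
  open ℤP.≤-Reasoning
  r₁ : ∀ x s b d → x ℤ.* s ℤ.* (b ℤ.* d) ≡ (x ℤ.* b) ℤ.* (s ℤ.* d)
  r₁ = solveℤ-∀
  r₂ : ∀ a r s d → (a ℤ.* r) ℤ.* (s ℤ.* d) ≡ (a ℤ.* d) ℤ.* (r ℤ.* s)
  r₂ = solveℤ-∀
  r₃ : ∀ y d b r → (y ℤ.* d) ℤ.* (b ℤ.* r) ≡ y ℤ.* r ℤ.* (b ℤ.* d)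
  r₃ = solveℤ-∀

_≃ℚ_/_ : ℚ → ℕ → ℕ → Set
x ≃ℚ a / b = toℚᵘ x ≃ a / b

infix 4 _≃ℚ_/_

≃ℚ-* : ∀ x y a b c d → x ≃ℚ a / b → y ≃ℚ c / d → x ℚ.* y ≃ℚ a * c / (b * d)
≃ℚ-* x y a b c d v₁ v₂ =
  ≃/-cong (toℚᵘ (x ℚ.* y)) (toℚᵘ x ℚᵘ.* toℚᵘ y) (a * c) (b * d)
    (ℚP.toℚᵘ-homo-* x y) (≃/-* (toℚᵘ x) (toℚᵘ y) a b c d v₁ v₂)

≃ℚ-⁴ : ∀ x a b → x ≃ℚ a / b → x ⁴ ≃ℚ a * a * a * a / (b * b * b * b)
≃ℚ-⁴ x a b v = ≃ℚ-* (x ℚ.* x ℚ.* x) x (a * a * a) (b * b * b) a b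
  (≃ℚ-* (x ℚ.* x) x (a * a) (b * b) a b (≃ℚ-* x x a b a b v v) v) v

≃ℚ-/ : ∀ k d' → + k ℚ./ suc d' ≃ℚ k / suc d'
≃ℚ-/ k d' = ≃/-cong (toℚᵘ (+ k ℚ./ suc d')) (mkℚᵘ (+ k) d') k (suc d') (ℚP.toℚᵘ-fromℚᵘ (mkℚᵘ (+ k) d')) refl

≃ℚ-≤ : ∀ x y a b' c d' → x ≃ℚ a / suc b' → y ≃ℚ c / suc d' → a * suc d' ≤ c * suc b' → x ℚ.≤ y
≃ℚ-≤ x y a b' c d' v₁ v₂ le = ℚP.toℚᵘ-cancel-≤ (≃/-≤ (toℚᵘ x) (toℚᵘ y) a b' c d' v₁ v₂ le)

module _ (p q' : ℕ) .(cop : Coprime p (suc q')) where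

  private
    ε : ℚ
    ε = mkℚ (+ p) q' cop
    q : ℕ
    q = suc q'

  1-ε≃ : p ≤ q → 1ℚ ℚ.- ε ≃ℚ q ∸ p / q
  1-ε≃ p≤q = ≃/-cong (toℚᵘ (1ℚ ℚ.- ε)) (mkℚᵘ (+ 1) 0 ℚᵘ.+ mkℚᵘ (ℤ.- (+ p)) q') (q ∸ p) q
    (ℚᵘP.≃-trans (ℚP.toℚᵘ-homo-+ 1ℚ (ℚ.- ε)) (ℚᵘP.+-cong (ℚᵘP.≃-refl {mkℚᵘ (+ 1) 0}) (ℚP.toℚᵘ-homo‿- ε)))
    (begin
      (+ 1 ℤ.* + q ℤ.+ ℤ.- (+ p) ℤ.* + 1) ℤ.* + q ≡⟨ regroup (+ 1) (+ p) (+ q) ⟩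
      (ℤ.- (+ p) ℤ.+ + q) ℤ.* (+ 1 ℤ.* + q)       ≡⟨ cong₂ ℤ._*_ (trans (ℤP.-m+n≡n⊖m p q) (ℤP.⊖-≥ p≤q))
                                                       (sym (ℤP.pos-* 1 q)) ⟩
      + (q ∸ p) ℤ.* + (1 * q)                     ∎)
    where
    open ≡-Reasoning
    regroup : ∀ o P Q → (o ℤ.* Q ℤ.+ ℤ.- P ℤ.* o) ℤ.* Q ≡ (ℤ.- P ℤ.+ Q) ℤ.* (o ℤ.* Q)
    regroup = solveℤ-∀

  1+ε≃ : 1ℚ ℚ.+ ε ≃ℚ q + p / q
  1+ε≃ = ≃/-cong (toℚᵘ (1ℚ ℚ.+ ε)) (mkℚᵘ (+ 1) 0 ℚᵘ.+ mkℚᵘ (+ p) q') (q + p) q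
    (ℚP.toℚᵘ-homo-+ 1ℚ ε)
    (begin
      (+ 1 ℤ.* + q ℤ.+ + p ℤ.* + 1) ℤ.* + q ≡⟨ regroup (+ 1) (+ p) (+ q) ⟩
      (+ q ℤ.+ + p) ℤ.* (+ 1 ℤ.* + q)       ≡⟨ cong₂ ℤ._*_ (sym (ℤP.pos-+ q p)) (sym (ℤP.pos-* 1 q)) ⟩
      + (q + p) ℤ.* + (1 * q)               ∎)
    where
    open ≡-Reasoning
    regroup : ∀ o P Q → (o ℤ.* Q ℤ.+ P ℤ.* o) ℤ.* Q ≡ (Q ℤ.+ P) ℤ.* (o ℤ.* Q)
    regroup = solveℤ-∀

  bound-holds-ℚ : ∀ H T' W M t → p ≤ q →
    H * ((q ∸ p) * M) ≤ W * ((q + p) * t) * suc T' →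
    (+ H ℚ./ suc T') ℚ.* (1ℚ ℚ.- ε) ℚ.* (+ M ℚ./ 1) ℚ.≤ (+ W ℚ./ 1) ℚ.* (1ℚ ℚ.+ ε) ℚ.* (+ t ℚ./ 1)
  bound-holds-ℚ H T' W M t p≤q le = ≃ℚ-≤ _ _ (H * (q ∸ p) * M) _ (W * (q + p) * t) _ lhs≃ rhs≃
    (subst₂ _≤_ (regroupˡ H (q ∸ p) M q) (regroupʳ W (q + p) t (suc T') q) (*-monoˡ-≤ q le))
    where
    h : ℚ
    h = + H ℚ./ suc T'
    w : ℚ
    w = + W ℚ./ 1
    lhs≃ = ≃ℚ-* (h ℚ.* (1ℚ ℚ.- ε)) (+ M ℚ./ 1) (H * (q ∸ p)) (suc T' * q) M 1
      (≃ℚ-* h (1ℚ ℚ.- ε) H (suc T') (q ∸ p) q (≃ℚ-/ H T') (1-ε≃ p≤q)) (≃ℚ-/ M 0)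
    rhs≃ = ≃ℚ-* (w ℚ.* (1ℚ ℚ.+ ε)) (+ t ℚ./ 1) (W * (q + p)) (1 * q) t 1
      (≃ℚ-* w (1ℚ ℚ.+ ε) W 1 (q + p) q (≃ℚ-/ W 0) 1+ε≃) (≃ℚ-/ t 0)
    regroupˡ : ∀ H d M q → H * (d * M) * q ≡ H * d * M * (1 * q * 1)
    regroupˡ = solve-∀
    regroupʳ : ∀ W s t T q → W * (s * t) * T * q ≡ W * s * t * (T * q * 1)
    regroupʳ = solve-∀

  fourth-power-bound-ℚ : ∀ B D' X Cnt Q →
    B * B * B * B * (p * p * p * p) * Cnt ≤ X * X * X * X * Q * (suc D' * suc D' * suc D' * suc D' * (q * q * q * q)) →
    ((+ B ℚ./ suc D') ⁴) ℚ.* (ε ⁴) ℚ.* (+ Cnt ℚ./ 1) ℚ.≤ ((+ X ℚ./ 1) ⁴) ℚ.* (+ Q ℚ./ 1)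
  fourth-power-bound-ℚ B D' X Cnt Q le =
    ≃ℚ-≤ _ _ (B ⁴ᴺ * p ⁴ᴺ * Cnt) _ (X ⁴ᴺ * Q) _ lhs≃ rhs≃
      (subst₂ _≤_ (sym (*-identityʳ _)) (sym (cong (X ⁴ᴺ * Q *_) (*-identityʳ _))) le)
    where
    _⁴ᴺ : ℕ → ℕ
    n ⁴ᴺ = n * n * n * n
    b : ℚ
    b = + B ℚ./ suc D'
    x : ℚ
    x = + X ℚ./ 1
    lhs≃ : (b ⁴) ℚ.* (ε ⁴) ℚ.* (+ Cnt ℚ./ 1) ≃ℚ B ⁴ᴺ * p ⁴ᴺ * Cnt / (suc D' ⁴ᴺ * q ⁴ᴺ * 1)
    lhs≃ = ≃ℚ-* ((b ⁴) ℚ.* (ε ⁴)) (+ Cnt ℚ./ 1) (B ⁴ᴺ * p ⁴ᴺ) (suc D' ⁴ᴺ * q ⁴ᴺ) Cnt 1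
      (≃ℚ-* (b ⁴) (ε ⁴) (B ⁴ᴺ) (suc D' ⁴ᴺ) (p ⁴ᴺ) (q ⁴ᴺ) (≃ℚ-⁴ b B (suc D') (≃ℚ-/ B D')) (≃ℚ-⁴ ε p q refl))
      (≃ℚ-/ Cnt 0)
    rhs≃ : (x ⁴) ℚ.* (+ Q ℚ./ 1) ≃ℚ X ⁴ᴺ * Q / (1 ⁴ᴺ * 1)
    rhs≃ = ≃ℚ-* (x ⁴) (+ Q ℚ./ 1) (X ⁴ᴺ) (1 ⁴ᴺ) Q 1 (≃ℚ-⁴ x X 1 (≃ℚ-/ X 0)) (≃ℚ-/ Q 0)

nCk>0 : ∀ n k → k ≤ n → 0 < n C k
nCk>0 n zero _ = s≤s z≤n
nCk>0 (suc n) (suc k) (s≤s k≤n) = subst (0 <_) (nCk+nC[k+1]≡[n+1]C[k+1] n k) (≤-trans (nCk>0 n k k≤n) (m≤m+n _ _))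

degree≤length : ∀ {n} (L : List (Subset n)) i → degree L i ≤ length L
degree≤length L i = subst (degree L i ≤_) (trans (∑-const L 1) (*-identityʳ _)) (∑-mono-≤ L (λ S → ⟦⟧≤1 (lookup S i)))

T-∧-proj₁ : ∀ {b c} → T (b ∧ c) → T b
T-∧-proj₁ {true} _ = tt

module Corollary (Q : ℕ) .{{_ : NonZero Q}} (m k : ℕ) (k≤m : k ≤ m) (p q' : ℕ) (p<q : p < suc q') .(cop : Coprime p (suc q')) where

  M : ℕ
  M = suc m
  t : ℕ
  t = suc k
  q : ℕ
  q = suc q'
  ε : ℚ
  ε = mkℚ (+ p) q' cop
  K : ℕ
  K = m C k
  -- B / A = (1 + ε) t / ((1 - ε) M)
  A : ℕ
  A = (q ∸ p) * M
  B : ℕ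
  B = (q + p) * t
  open Hitting M t A B

  instance
    qQ≢0 : NonZero (q * Q)
    qQ≢0 = m*n≢0 q Q

  K>0 : 0 < K
  K>0 = nCk>0 m k k≤m

  N : Fin M → Fin Q → Vec (Fin Q) M → ℕ
  N i c a = Moments.N Q M t i (toℕ c) (toℕ<n c) a

  deviates : Vec (Fin Q) M → Fin Q → Fin M → Bool
  deviates a c i = deviatesᵇ p q K (Q * N i c a)

  degree-choices : ∀ a c i → degree (choices a t c) i ≡ N i c a
  degree-choices a c i = trans (∑-filter _ (subsets M) _) (∑-cong (subsets M) λ S →
    trans (cong (_* ⟦ lookup S i ⟧) (⟦∧⟧ (∣ S ∣ ≡ᵇ t) _)) (xy∙z≈xz∙y ⟦ ∣ S ∣ ≡ᵇ t ⟧ _ ⟦ lookup S i ⟧))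
    where
    xy∙z≈xz∙y : ∀ x y z → x * y * z ≡ x * z * y
    xy∙z≈xz∙y = solve-∀

  choices-size : ∀ a c → All (λ S → ∣ S ∣ ≡ t) (choices a t c)
  choices-size a c = All.map (λ h → ≡ᵇ⇒≡ _ _ (T-∧-proj₁ h)) (all-filter _ (subsets M))

  ∑Fin-N : ∀ a c → ∑Fin M (λ i → N i c a) ≡ t * length (choices a t c)
  ∑Fin-N a c = trans (∑Fin-cong M (λ i → sym (degree-choices a c i))) (∑Fin-degree t (choices a t c) (choices-size a c))

  -- Each N i c a is near K / Q while they sum to t · |choices|; so no point is overused.
  balanced : ∀ a c → (∀ i → deviates a c i ≡ false) → Balanced (choices a t c)
  balanced a c calm i = *-cancelʳ-≤ _ _ (q * Q) (begin
    degree L i * A * (q * Q)       ≡⟨ cong (λ u → u * A * (q * Q)) (degree-choices a c i) ⟩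
    N i c a * A * (q * Q)          ≡⟨ r₁ (N i c a) A q Q ⟩
    y i * A                        ≤⟨ *-monoˡ-≤ A (proj₂ (bounds i)) ⟩
    (q + p) * K * ((q ∸ p) * M)    ≡⟨ r₂ (q + p) K (q ∸ p) M ⟩
    (q + p) * (M * ((q ∸ p) * K))  ≡⟨ cong ((q + p) *_) (∑Fin-const M _) ⟨
    (q + p) * ∑Fin M (λ _ → (q ∸ p) * K) ≤⟨ *-monoʳ-≤ (q + p) (∑Fin-mono-≤ M (λ j → proj₁ (bounds j))) ⟩
    (q + p) * ∑Fin M y             ≡⟨ cong ((q + p) *_) ∑Fin-y ⟩
    (q + p) * (q * Q * (t * length L)) ≡⟨ r₃ (q + p) (q * Q) t (length L) ⟩
    B * length L * (q * Q)         ∎)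
    where
    open ≤-Reasoning
    L : List (Subset M)
    L = choices a t c
    y : Fin M → ℕ
    y j = q * (Q * N j c a)
    bounds : ∀ j → ((q ∸ p) * K ≤ y j) × (y j ≤ (q + p) * K)
    bounds j = ¬deviates⇒bounds p q K (Q * N j c a) (calm j)
    r₄ : ∀ q Q n → q * (Q * n) ≡ n * (q * Q)
    r₄ = solve-∀
    ∑Fin-y : ∑Fin M y ≡ q * Q * (t * length L)
    ∑Fin-y = begin-equality
      ∑Fin M (λ j → q * (Q * N j c a))   ≡⟨ ∑Fin-cong M (λ j → r₄ q Q (N j c a)) ⟩
      ∑Fin M (λ j → N j c a * (q * Q))   ≡⟨ ∑Fin-*ʳ M (λ j → N j c a) (q * Q) ⟩
      ∑Fin M (λ j → N j c a) * (q * Q)   ≡⟨ cong (_* (q * Q)) (∑Fin-N a c) ⟩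
      t * length L * (q * Q)             ≡⟨ *-comm _ (q * Q) ⟩
      q * Q * (t * length L)             ∎
    r₁ : ∀ n a q Q → n * a * (q * Q) ≡ q * (Q * n) * a
    r₁ = solve-∀
    r₂ : ∀ s c d M → s * c * (d * M) ≡ s * (M * (d * c))
    r₂ = solve-∀
    r₃ : ∀ s x t l → s * (x * (t * l)) ≡ s * t * l * x
    r₃ = solve-∀

  choices-nonempty : ∀ a c → (∀ i → deviates a c i ≡ false) → 0 < length (choices a t c)
  choices-nonempty a c calm = <-≤-trans N>0 (subst (_≤ length (choices a t c)) (degree-choices a c zero) (degree≤length (choices a t c) zero))
    where
    N>0 : 0 < N zero c a
    N>0 = n≢0⇒n>0 λ N≡0 → <⇒≱ (*-mono-≤ (m<n⇒0<n∸m p<q) K>0)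
      (subst ((q ∸ p) * K ≤_) (trans (cong (λ n → q * (Q * n)) N≡0) (trans (cong (q *_) (*-zeroʳ Q)) (*-zeroʳ q)))
        (proj₁ (¬deviates⇒bounds p q K _ (calm zero))))

  choiceLists : ∀ {M'} → Vec (Fin Q) M → Vec (Fin Q) M' → Subset M' → List (List (Subset M))
  choiceLists a c J = map (λ j → choices a t (lookup c j)) (elems J)

  hittingProb≡ : ∀ {M'} a (c : Vec (Fin Q) M') I J T' → #tuples (choiceLists a c J) ≡ suc T' →
    hittingProb a c I J t ≡ frac (#hitting I (choiceLists a c J)) (suc T')
  hittingProb≡ a c I J T' e with tuples (choiceLists a c J) | e
  ... | x ∷ xs | e' = cong₂ frac (length-filter (hitᵇ I) (x ∷ xs))
                                 (trans (sym (trans (∑-const (x ∷ xs) 1) (*-identityʳ _))) e')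

  length-elems : ∀ {n} (J : Subset n) → length (elems J) ≡ ∣ J ∣
  length-elems {n} J = trans (length-filter (lookup J) (allFin n)) (trans (∑-allFin n _) (sym (∣S∣≡∑Fin J)))

  all-choices : ∀ {M'} {P : List (Subset M) → Set} a (c : Vec (Fin Q) M') J →
    (∀ j → P (choices a t (lookup c j))) → All P (choiceLists a c J)
  all-choices a c J h = map⁺ (All.universal h (elems J))

  bound-holds : ∀ {M'} v v' a (c : Vec (Fin Q) M') I J → ∣ I ∣ ≤ v → ∣ J ∣ ≤ v' →
    (∀ i j → deviates a (lookup c j) i ≡ false) → boundFailsᵇ v v' ε a c I J t ≡ false
  bound-holds v v' a c I J ∣I∣≤v ∣J∣≤v' calm
    with #tuples (choiceLists a c J) in #tuples≡
       | #tuples>0 (choiceLists a c J) (all-choices a c J (λ j → choices-nonempty a (lookup c j) (λ i → calm i j)))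
  ... | suc T' | _ = cong not (T⇒≡true (ℚP.≤⇒≤ᵇ (subst
        (λ x → x ℚ.* (1ℚ ℚ.- ε) ℚ.* (+ M ℚ./ 1) ℚ.≤ (+ W ℚ./ 1) ℚ.* (1ℚ ℚ.+ ε) ℚ.* (+ t ℚ./ 1))
        (sym (hittingProb≡ a c I J T' #tuples≡))
        (bound-holds-ℚ p q' cop (#hitting I Ls) T' W M t (<⇒≤ p<q) (subst (λ z → #hitting I Ls * A ≤ W * B * z) #tuples≡ #hitting≤)))))
    where
    Ls : List (List (Subset M))
    Ls = choiceLists a c J
    W : ℕ
    W = (v + t * v') * v'
    k≤v' : length Ls ≤ v'
    k≤v' = subst (_≤ v') (sym (trans (length-map _ (elems J)) (length-elems J))) ∣J∣≤v'
    coefficient≤ : ∣ I ∣ * length Ls + t * (length Ls * length Ls) ≤ W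
    coefficient≤ = subst (∣ I ∣ * length Ls + t * (length Ls * length Ls) ≤_) (factor v v' t)
      (+-mono-≤ (*-mono-≤ ∣I∣≤v k≤v') (*-monoʳ-≤ t (*-mono-≤ k≤v' k≤v')))
      where
      factor : ∀ v v' t → v * v' + t * (v' * v') ≡ (v + t * v') * v'
      factor = solve-∀
    #hitting≤ : #hitting I Ls * A ≤ W * B * #tuples Ls
    #hitting≤ = ≤-trans
      (#hitting-bound I Ls (all-choices a c J (λ j → balanced a (lookup c j) (λ i → calm i j)))
                           (all-choices a c J (λ j → choices-size a (lookup c j))))
      (*-monoˡ-≤ (#tuples Ls) (*-monoˡ-≤ B coefficient≤))

  any-≡false : {A : Set} (f : A → Bool) (xs : List A) → (∀ x → f x ≡ false) → any f xs ≡ false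
  any-≡false f [] _ = refl
  any-≡false f (x ∷ xs) h rewrite h x = any-≡false f xs h

  ∧-≡false : ∀ (b : Bool) {c : Bool} → (b ≡ true → c ≡ false) → b ∧ c ≡ false
  ∧-≡false true h = h refl
  ∧-≡false false h = refl

  calm⇒¬bad : ∀ {M'} v v' a (c : Vec (Fin Q) M') → (∀ i j → deviates a (lookup c j) i ≡ false) → badᵇ t v v' ε a c ≡ false
  calm⇒¬bad {M'} v v' a c calm =
    any-≡false _ (subsets M) λ I → ∧-≡false (∣ I ∣ ≤ᵇ v) λ I≤v →
    any-≡false _ (subsets M') λ J → ∧-≡false (∣ J ∣ ≤ᵇ v') λ J≤v' →
    bound-holds v v' a c I J (≤ᵇ⇒≤ _ _ (subst T (sym I≤v) tt)) (≤ᵇ⇒≤ _ _ (subst T (sym J≤v') tt)) calm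

  module _ (M' v v' : ℕ) where

    bad : Vec (Fin Q) M → Vec (Fin Q) M' → Bool
    bad a c = badᵇ t v v' ε a c

    #deviations : Vec (Fin Q) M → Vec (Fin Q) M' → ℕ
    #deviations a c = ∑Fin M (λ i → ∑Fin M' (λ j → ⟦ deviates a (lookup c j) i ⟧))

    bad≤#deviations : ∀ a c → ⟦ bad a c ⟧ ≤ #deviations a c
    bad≤#deviations a c with #deviations a c in e
    ... | suc _ = ≤-trans (⟦⟧≤1 (bad a c)) (s≤s z≤n)
    ... | zero = ≤-reflexive (cong ⟦_⟧ (calm⇒¬bad v v' a c λ i j → ⟦⟧≡0⇒false _
          (∑Fin≡0⇒≡0 M' _ (∑Fin≡0⇒≡0 M (λ i → ∑Fin M' (λ j → ⟦ deviates a (lookup c j) i ⟧)) e i) j)))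

    #bad : ℕ
    #bad = ∑ (vectors Q M) (λ a → ∑ (vectors Q M') (λ c → ⟦ bad a c ⟧))

    #deviating : Fin M → Fin M' → ℕ
    #deviating i j = ∑ (vectors Q M) (λ a → ∑ (vectors Q M') (λ c → ⟦ deviates a (lookup c j) i ⟧))

    #bad≤∑#deviating : #bad ≤ ∑Fin M (λ i → ∑Fin M' (#deviating i))
    #bad≤∑#deviating = begin
      #bad
        ≤⟨ ∑-mono-≤ (vectors Q M) (λ a → ∑-mono-≤ (vectors Q M') (bad≤#deviations a)) ⟩
      ∑ (vectors Q M) (λ a → ∑ (vectors Q M') (#deviations a))
        ≡⟨ ∑-cong (vectors Q M) (λ a → ∑-∑Fin-comm (vectors Q M') M (λ c i → ∑Fin M' (λ j → ⟦ deviates a (lookup c j) i ⟧))) ⟩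
      ∑ (vectors Q M) (λ a → ∑Fin M (λ i → ∑ (vectors Q M') (λ c → ∑Fin M' (λ j → ⟦ deviates a (lookup c j) i ⟧))))
        ≡⟨ ∑-∑Fin-comm (vectors Q M) M (λ a i → ∑ (vectors Q M') (λ c → ∑Fin M' (λ j → ⟦ deviates a (lookup c j) i ⟧))) ⟩
      ∑Fin M (λ i → ∑ (vectors Q M) (λ a → ∑ (vectors Q M') (λ c → ∑Fin M' (λ j → ⟦ deviates a (lookup c j) i ⟧))))
        ≡⟨ ∑Fin-cong M (λ i → trans (∑-cong (vectors Q M) (λ a → ∑-∑Fin-comm (vectors Q M') M' (λ c j → ⟦ deviates a (lookup c j) i ⟧)))
                                    (∑-∑Fin-comm (vectors Q M) M' (λ a j → ∑ (vectors Q M') (λ c → ⟦ deviates a (lookup c j) i ⟧)))) ⟩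
      ∑Fin M (λ i → ∑Fin M' (#deviating i)) ∎
      where open ≤-Reasoning

    chebyshev-at : ∀ (c : Fin Q) i → ∑ (vectors Q M) (λ a → ⟦ deviates a c i ⟧) * (p * p * K) ≤ q * q * Q ^ suc M
    chebyshev-at c i = subst (λ K' → ∑ (vectors Q M) (λ a → ⟦ deviatesᵇ p q K' (Q * N i c a) ⟧) * (p * p * K') ≤ q * q * Q ^ suc M)
      (count-subsets-of-size-containing m k i)
      (Moments.chebyshev Q M t i (toℕ c) (toℕ<n c) p q (<⇒≤ p<q) (subst (0 <_) (sym (count-subsets-of-size-containing m k i)) K>0))

    R : ℕ
    R = Q ^ M' * (q * q * Q ^ suc M)

    -- Only the coordinate c_j matters, and it is uniform.
    #deviating-bound : ∀ i j → #deviating i j * (p * p * K) ≤ R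
    #deviating-bound i j = *-cancelʳ-≤ _ _ Q (begin
      #deviating i j * (p * p * K) * Q
        ≡⟨ r₁ (#deviating i j) (p * p * K) Q ⟩
      Q * #deviating i j * (p * p * K)
        ≡⟨ cong (_* (p * p * K)) only-c_j ⟩
      Q ^ M' * ∑ (allFin Q) (λ c' → ∑ (vectors Q M) (λ a → ⟦ deviates a c' i ⟧)) * (p * p * K)
        ≡⟨ trans (*-assoc (Q ^ M') _ _) (cong (Q ^ M' *_) (sym (∑-*ʳ (allFin Q) _ _))) ⟩
      Q ^ M' * ∑ (allFin Q) (λ c' → ∑ (vectors Q M) (λ a → ⟦ deviates a c' i ⟧) * (p * p * K))
        ≤⟨ *-monoʳ-≤ (Q ^ M') (∑-mono-≤ (allFin Q) (λ c' → chebyshev-at c' i)) ⟩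
      Q ^ M' * ∑ (allFin Q) (λ c' → q * q * Q ^ suc M)
        ≡⟨ cong (Q ^ M' *_) (∑-allFin-const Q _) ⟩
      Q ^ M' * (Q * (q * q * Q ^ suc M))
        ≡⟨ r₂ (Q ^ M') Q (q * q * Q ^ suc M) ⟩
      R * Q ∎)
      where
      open ≤-Reasoning
      r₁ : ∀ x c Q → x * c * Q ≡ Q * x * c
      r₁ = solve-∀
      r₂ : ∀ a Q b → a * (Q * b) ≡ a * b * Q
      r₂ = solve-∀
      only-c_j : Q * #deviating i j ≡ Q ^ M' * ∑ (allFin Q) (λ c' → ∑ (vectors Q M) (λ a → ⟦ deviates a c' i ⟧))
      only-c_j = begin-equality
        Q * #deviating i j
          ≡⟨ ∑-*ˡ (vectors Q M) Q _ ⟨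
        ∑ (vectors Q M) (λ a → Q * ∑ (vectors Q M') (λ c → ⟦ deviates a (lookup c j) i ⟧))
          ≡⟨ ∑-cong (vectors Q M) (λ a → ∑-vectors-lookup Q M' j (λ c' → ⟦ deviates a c' i ⟧)) ⟩
        ∑ (vectors Q M) (λ a → Q ^ M' * ∑ (allFin Q) (λ c' → ⟦ deviates a c' i ⟧))
          ≡⟨ ∑-*ˡ (vectors Q M) (Q ^ M') _ ⟩
        Q ^ M' * ∑ (vectors Q M) (λ a → ∑ (allFin Q) (λ c' → ⟦ deviates a c' i ⟧))
          ≡⟨ cong (Q ^ M' *_) (∑-comm (vectors Q M) (allFin Q) _) ⟩
        Q ^ M' * ∑ (allFin Q) (λ c' → ∑ (vectors Q M) (λ a → ⟦ deviates a c' i ⟧)) ∎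

    #bad-bound : #bad * (p * p * K) ≤ M * (M' * R)
    #bad-bound = begin
      #bad * (p * p * K)
        ≤⟨ *-monoˡ-≤ _ #bad≤∑#deviating ⟩
      ∑Fin M (λ i → ∑Fin M' (#deviating i)) * (p * p * K)
        ≡⟨ trans (sym (∑Fin-*ʳ M (λ i → ∑Fin M' (#deviating i)) (p * p * K)))
                 (∑Fin-cong M (λ i → sym (∑Fin-*ʳ M' (#deviating i) (p * p * K)))) ⟩
      ∑Fin M (λ i → ∑Fin M' (λ j → #deviating i j * (p * p * K)))
        ≤⟨ ∑Fin-mono-≤ M (λ i → ∑Fin-mono-≤ M' (#deviating-bound i)) ⟩
      ∑Fin M (λ i → ∑Fin M' (λ j → R))
        ≡⟨ trans (∑Fin-cong M (λ i → ∑Fin-const M' R)) (∑Fin-const M _) ⟩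
      M * (M' * R) ∎
      where open ≤-Reasoning

    #bad≤total : #bad ≤ Q ^ M * Q ^ M'
    #bad≤total = begin
      #bad
        ≤⟨ ∑-mono-≤ (vectors Q M) (λ a → ∑-mono-≤ (vectors Q M') (λ c → ⟦⟧≤1 (bad a c))) ⟩
      ∑ (vectors Q M) (λ a → ∑ (vectors Q M') (λ c → 1))
        ≡⟨ ∑-cong (vectors Q M) (λ a → count-vectors Q M') ⟩
      ∑ (vectors Q M) (λ a → Q ^ M')
        ≡⟨ ∑-vectors-const Q M (Q ^ M') ⟩
      Q ^ M * Q ^ M' ∎
      where open ≤-Reasoning

    badProb≡ : badProb Q M M' t v v' ε ≡ frac #bad (Q ^ M * Q ^ M')
    badProb≡ = cong (λ z → frac z (Q ^ M * Q ^ M'))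
      (trans (length-filter _ (List.cartesianProduct (vectors Q M) (vectors Q M'))) (∑-cartesianProduct (vectors Q M) (vectors Q M') _))

    -- x = b / total satisfies x ≤ 1 and x ε² K ≤ M M' Q, hence x⁴ ε⁴ K ≤ M M' Q ≤ (4 M M')⁴ Q.
    frac-bound : ∀ b total → total ≡ Q ^ M * Q ^ M' → b ≤ total → b * (p * p * K) ≤ M * (M' * R) →
      (frac b total ⁴) ℚ.* (ε ⁴) ℚ.* (+ K ℚ./ 1) ℚ.≤ ((+ (4 * M * M') ℚ./ 1) ⁴) ℚ.* (+ Q ℚ./ 1)
    frac-bound b zero total≡ _ _ = ⊥-elim (ℕ.≢-nonZero⁻¹ (Q ^ M * Q ^ M') {{m*n≢0 (Q ^ M) (Q ^ M') {{m^n≢0 Q M}} {{m^n≢0 Q M'}}}} (sym total≡))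
    frac-bound b (suc D') total≡ b≤D b-bound = fourth-power-bound-ℚ p q' cop b D' X K Q (begin
      b * b * b * b * (p * p * p * p) * K     ≡⟨ r₁ b p K ⟩
      (b * b * b * (p * p)) * (b * (p * p * K))
        ≤⟨ *-mono-≤ (*-mono-≤ (*-mono-≤ (*-mono-≤ b≤D b≤D) b≤D) (*-mono-≤ p≤q p≤q)) b-bound ⟩
      (D * D * D * (q * q)) * (M * (M' * R))
        ≡⟨ cong ((D * D * D * (q * q)) *_) (trans (r₂ M M' (Q ^ M') q Q (Q ^ M)) (cong (M * M' * q * q * Q *_) (sym total≡))) ⟩
      (D * D * D * (q * q)) * (M * M' * q * q * Q * D)     ≡⟨ r₃ D q (M * M') Q ⟩
      M * M' * Q * (D * D * D * D * (q * q * q * q))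
        ≤⟨ *-monoˡ-≤ _ (*-monoˡ-≤ Q (subst (M * M' ≤_) (cong (λ x → x * x * x * x) (sym (*-assoc 4 M M'))) (n≤[4n]⁴ (M * M')))) ⟩
      X * X * X * X * Q * (D * D * D * D * (q * q * q * q)) ∎)
      where
      open ≤-Reasoning
      D : ℕ
      D = suc D'
      X : ℕ
      X = 4 * M * M'
      p≤q : p ≤ q
      p≤q = <⇒≤ p<q
      n≤[4n]⁴ : ∀ n → n ≤ (4 * n) * (4 * n) * (4 * n) * (4 * n)
      n≤[4n]⁴ zero = z≤n
      n≤[4n]⁴ n@(suc _) = ≤-trans (m≤n*m n 4) (≤-trans (m≤m*n (4 * n) ((4 * n) * (4 * n) * (4 * n))) (≤-reflexive (r₀ (4 * n))))
        where
        r₀ : ∀ x → x * (x * x * x) ≡ x * x * x * x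
        r₀ = solve-∀
      r₁ : ∀ b p c → b * b * b * b * (p * p * p * p) * c ≡ (b * b * b * (p * p)) * (b * (p * p * c))
      r₁ = solve-∀
      r₂ : ∀ M M' a q Q b → M * (M' * (a * (q * q * (Q * b)))) ≡ M * M' * q * q * Q * (b * a)
      r₂ = solve-∀
      r₃ : ∀ D q n Q → (D * D * D * (q * q)) * (n * q * q * Q * D) ≡ n * Q * (D * D * D * D * (q * q * q * q))
      r₃ = solve-∀

    badProb-bound : (badProb Q M M' t v v' ε ⁴) ℚ.* (ε ⁴) ℚ.* (+ K ℚ./ 1) ℚ.≤ ((+ (4 * M * M') ℚ./ 1) ⁴) ℚ.* (+ Q ℚ./ 1)
    badProb-bound = subst (λ x → (x ⁴) ℚ.* (ε ⁴) ℚ.* (+ K ℚ./ 1) ℚ.≤ ((+ (4 * M * M') ℚ./ 1) ⁴) ℚ.* (+ Q ℚ./ 1)) (sym badProb≡)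
      (frac-bound #bad (Q ^ M * Q ^ M') refl #bad≤total #bad-bound)

corollary2p7 : (Q M M' t v v' : ℕ) → .{{_ : NonZero Q}} → .{{_ : NonZero M}} →
    .{{_ : NonZero M'}} → .{{_ : NonZero t}} → .{{_ : NonZero v}} → .{{_ : NonZero v'}} →
    t ≤ M → (ε : ℚ) → 0ℚ ℚ.< ε → ε ℚ.< 1ℚ →
    (badProb Q M M' t v v' ε ⁴) ℚ.* (ε ⁴) ℚ.* (+ ((M ∸ 1) C (t ∸ 1)) ℚ./ 1)
    ℚ.≤ ((+ (4 ℕ.* M ℕ.* M') ℚ./ 1) ⁴) ℚ.* (+ Q ℚ./ 1)
corollary2p7 Q zero M' t v v' {{_}} {{M≢0}} _ ε _ _ = ⊥-elim (ℕ.≢-nonZero⁻¹ zero {{M≢0}} refl)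
corollary2p7 Q (suc m) M' zero v v' {{_}} {{_}} {{_}} {{t≢0}} _ ε _ _ = ⊥-elim (ℕ.≢-nonZero⁻¹ zero {{t≢0}} refl)
corollary2p7 Q (suc m) M' (suc k) v v' (s≤s k≤m) (mkℚ (+ p) q' cop) _ (ℚ.*<* p*1<1*q) =
  Corollary.badProb-bound Q m k k≤m p q' p<q cop M' v v'
  where
  p<q : p < suc q'
  p<q = ℤP.drop‿+<+ (subst₂ ℤ._<_ (ℤP.*-identityʳ (+ p)) (ℤP.*-identityˡ (+ suc q')) p*1<1*q)
corollary2p7 Q (suc m) M' (suc k) v v' (s≤s k≤m) (mkℚ -[1+ n ] q' c) (ℚ.*<* ()) _
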